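{- Let $n$ be a positive integer. If $n$ is even, then \[ 2^{n-1}A_n(t)=\sum_{r=0}^{(n-2)/2}\binom{n}{2r+1}B_{2r+1}(t)(t-1)^{n-2r-2}. \] If $n$ is odd, then \[ 2^{n-1}A_n(t)=\sum_{r=0}^{(n-1)/2}\binom{n}{2r}B_{2r}(t)(t-1)^{n-2r-1}. \]
   Context: $A_n(t)=\sum_{\pi}t^{\mathrm{des}(\pi)}$ over all permutations $\pi$ of $[n]$, with $\mathrm{des}(\pi)=|\{i\in[n-1]:\pi_i>\pi_{i+1}\}|$. $B_m(t)=\sum_{\pi\in\mathfrak{B}_m}t^{\mathrm{des}_B(\pi)}$, where $\mathfrak{B}_m$ is the set of signed permutations $\pi_1\cdots\pi_m$ of $[m]$ and, with $\pi_0=0$, $\mathrm{des}_B(\pi)=|\{i\in\{0,\dots,m-1\}:\pi_i>\pi_{i+1}\}|$; by convention $B_0(t)=1$. -}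

module Defs where

open import Data.Bool using (Bool; _≟_; true; false; not; _∧_; if_then_else_)
open import Data.Nat as ℕ using (ℕ; zero; suc)
import Data.Nat.Properties as ℕP
open import Data.Integer as ℤ using (ℤ; +_; -[1+_]; ∣_∣)
import Data.Integer.Properties as ℤP
open import Data.List using (List; []; _∷_; map; concatMap; filter; upTo; sum; foldr; _++_; length)
open import Relation.Nullary.Decidable using (⌊_⌋)
open import Relation.Binary.PropositionalEquality using (_≡_)

words : {A : Set} → ℕ → List A → List (List A)
words zero    alph = [] ∷ []
words (suc m) alph = concatMap (λ a → map (a ∷_) (words m alph)) alph

notElem : ℕ → List ℕ → Bool
notElem a []       = true
notElem a (x ∷ xs) = not ⌊ a ℕP.≟ x ⌋ ∧ notElem a xs

distinct : List ℕ → Bool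
distinct []       = true
distinct (x ∷ xs) = notElem x xs ∧ distinct xs

range : ℕ → List ℕ
range n = map suc (upTo n)

perms : ℕ → List (List ℕ)
perms n = filter (λ w → _≟_ (distinct w) true) (words n (range n))

signedAlphabet : ℕ → List ℤ
signedAlphabet m = map (λ i → + i) (range m) ++ map (λ i → ℤ.- (+ i)) (range m)

signedPerms : ℕ → List (List ℤ)
signedPerms m = filter (λ w → _≟_ (distinct (map ∣_∣ w)) true) (words m (signedAlphabet m))

des : List ℕ → ℕ
des []           = 0
des (x ∷ [])     = 0
des (x ∷ y ∷ xs) = (if ⌊ y ℕ.<? x ⌋ then 1 else 0) ℕ.+ des (y ∷ xs)

desℤ : List ℤ → ℕ
desℤ []           = 0
desℤ (x ∷ [])     = 0
desℤ (x ∷ y ∷ xs) = (if ⌊ y ℤ.<? x ⌋ then 1 else 0) ℕ.+ desℤ (y ∷ xs)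

desB : List ℤ → ℕ
desB w = desℤ (+ 0 ∷ w)

sumℤ : List ℤ → ℤ
sumℤ = foldr ℤ._+_ (+ 0)

A : ℕ → ℤ → ℤ
A n t = sumℤ (map (λ π → t ℤ.^ des π) (perms n))

-- type-B Eulerian polynomial B_m evaluated at t  (B₀ = 1 automatically)
B : ℕ → ℤ → ℤ
B m t = sumℤ (map (λ π → t ℤ.^ desB π) (signedPerms m))

-- Encode Aₙ(t) and B_k(t) by their coefficient sequences (the Eulerian numbers of type A and B)
-- and let S be the partial-sum operator on sequences, i.e. multiplication of a power series by
-- 1/(1 - t). Inserting the new largest letter into the permutations of [n] (respectively ±(k+1)
-- into the signed permutations of [k]) gives the Worpitzky identities Sⁿ⁺¹(Aₙ)ₘ = (m + 1)ⁿ and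
-- Sᵏ⁺¹(B_k)ₘ = (2m + 1)ᵏ. Let k run over 0 ≤ k ≤ n - 1 with n - 1 - k even. Multiplication by
-- (1 - t)ʲ undoes j applications of S and (t - 1)ⁿ⁻¹⁻ᵏ = (1 - t)ⁿ⁻¹⁻ᵏ, so the (n+1)-fold partial
-- sums of the coefficients of Σₖ C(n,k) B_k(t) (t - 1)ⁿ⁻¹⁻ᵏ are Σ_{i ≤ m} Σₖ C(n,k) (2i + 1)ᵏ.
-- By the binomial theorem 2 Σₖ C(n,k) xᵏ = (x + 1)ⁿ - (x - 1)ⁿ, so at x = 2i + 1 this telescopes
-- to (2m + 2)ⁿ / 2 = 2ⁿ⁻¹ (m + 1)ⁿ, the (n+1)-fold partial sums of the coefficients of 2ⁿ⁻¹ Aₙ(t).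
-- S is injective, so the two coefficient sequences, and hence the two polynomials, agree.

module Submission where

open import Defs

module EulerianIdentities where
  open import Data.Bool using (Bool; true; false; if_then_else_; _∧_)
  import Data.Bool as Bool
  open import Data.Nat as ℕ using (ℕ; zero; suc; z≤n; s≤s; z<s; s<s; _≤_; _<_; _∸_; _%_; _/_)
  open import Data.Nat.DivMod using (m*n%n≡0; [m+kn]%n≡m%n; m*n/n≡m)
  import Data.Nat.Properties as ℕP
  open import Data.Nat.Combinatorics using (_C_)
  open import Data.Integer as ℤ using (ℤ; +_; -[1+_]; _+_; _*_; _-_; -_; _^_; ∣_∣)
  import Data.Integer.Properties as ℤP
  import Algebra.Properties.CommutativeSemiring.Binomial ℤP.+-*-commutativeSemiring as Binomial
  open import Algebra.Properties.CommutativeSemiring.Exp ℤP.+-*-commutativeSemiring using () renaming (_^_ to _^ₛ_)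
  open import Algebra.Properties.Semiring.Mult ℤP.+-*-semiring using () renaming (_×_ to _×ₛ_)
  open import Data.Fin using (toℕ)
  import Data.Vec.Functional as Vector
  open import Algebra.Properties.AbelianGroup ℤP.+-0-abelianGroup using (∙-cancelˡ)
  open import Data.Integer.Tactic.RingSolver using (solve-∀)
  open import Data.Nat.Tactic.RingSolver using () renaming (solve-∀ to solveℕ-∀)
  open import Data.List using (List; []; _∷_; _++_; map; concatMap; length; upTo; applyUpTo)
  open import Data.List.Membership.Propositional using (_∈_; _∉_; find; lose)
  open import Data.List.Membership.Propositional.Properties
    using (∈-concatMap⁺; ∈-concatMap⁻; ∈-map⁺; ∈-map⁻; ∈-∃++; ∈-++⁺ˡ; ∈-++⁺ʳ; ∈-++⁻; ∈-filter⁺; ∈-filter⁻; ∈-upTo⁺; ∈-upTo⁻)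
  open import Data.List.Membership.DecPropositional ℕP._≟_ using (_∈?_)
  open import Data.List.Membership.Propositional.Properties.WithK using (unique∧set⇒bag)
  open import Data.List.Relation.Binary.BagAndSetEquality using (∼bag⇒↭)
  open import Data.List.Relation.Binary.Disjoint.Propositional using (Disjoint)
  open import Data.List.Relation.Binary.Permutation.Propositional
    using (_↭_; ↭⇒↭ₛ; ↭-refl; ↭-prep; ↭-swap; ↭-sym; ↭-trans)
  open import Data.List.Relation.Binary.Permutation.Propositional.Properties
    using (map⁺; All-resp-↭; ∈-resp-↭; ↭-length) renaming (shift to ↭-shift)
  import Data.List.Relation.Binary.Permutation.Setoid.Properties as PermutationSetoid
  open import Data.List.Relation.Unary.All as All using (All; []; _∷_)
  open import Data.List.Relation.Unary.Any using (here; there)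
  open import Data.List.Relation.Unary.Unique.Propositional using (Unique; []; _∷_)
  import Data.List.Relation.Unary.Unique.Propositional.Properties as Unique
  open import Data.Product using (∃-syntax; _×_; _,_; proj₁; proj₂)
  open import Data.Sum using (inj₁; inj₂)
  open import Function using (_∘_; id; mk⇔)
  open import Relation.Binary.Definitions using (DecidableEquality)
  open import Relation.Nullary using (Dec; yes; no; ¬_; contradiction)
  open import Relation.Nullary.Decidable using (⌊_⌋; isYes≗does; dec-true; dec-false)
  open import Data.Empty using (⊥; ⊥-elim)
  open import Data.List.Properties using (∷-injectiveˡ; ∷-injectiveʳ; length-map; map-∘)
  import Data.List.Relation.Unary.All.Properties as AllP
  open import Relation.Binary.PropositionalEquality

  variable
    U V : Set

  -- Finite sums

  ∑ : List U → (U → ℤ) → ℤ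
  ∑ xs g = sumℤ (map g xs)

  infix 5 ∑
  syntax ∑ xs (λ x → e) = ∑[ x ∈ xs ] e

  ∑-++ : (xs ys : List U) (g : U → ℤ) → ∑ (xs ++ ys) g ≡ ∑ xs g + ∑ ys g
  ∑-++ []       ys g = sym (ℤP.+-identityˡ _)
  ∑-++ (x ∷ xs) ys g = trans (cong (_+_ (g x)) (∑-++ xs ys g)) (sym (ℤP.+-assoc (g x) _ _))

  ∑-concatMap : (f : U → List V) (xs : List U) (g : V → ℤ) →
    ∑ (concatMap f xs) g ≡ ∑[ x ∈ xs ] ∑ (f x) g
  ∑-concatMap f []       g = refl
  ∑-concatMap f (x ∷ xs) g =
    trans (∑-++ (f x) (concatMap f xs) g) (cong (_+_ (∑ (f x) g)) (∑-concatMap f xs g))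

  ∑-map : (f : U → V) (xs : List U) (g : V → ℤ) → ∑ (map f xs) g ≡ ∑ xs (g ∘ f)
  ∑-map f xs g = cong sumℤ (sym (map-∘ xs))

  ∑-cong : (xs : List U) {g h : U → ℤ} → (∀ {x} → x ∈ xs → g x ≡ h x) → ∑ xs g ≡ ∑ xs h
  ∑-cong []       eq = refl
  ∑-cong (x ∷ xs) eq = cong₂ _+_ (eq (here refl)) (∑-cong xs (eq ∘ there))

  ∑-+ : (xs : List U) (g h : U → ℤ) → ∑[ x ∈ xs ] (g x + h x) ≡ ∑ xs g + ∑ xs h
  ∑-+ []       g h = refl
  ∑-+ (x ∷ xs) g h = trans (cong (_+_ (g x + h x)) (∑-+ xs g h)) (interchange (g x) (h x) _ _)
    where
    interchange : ∀ a b c d → a + b + (c + d) ≡ a + c + (b + d)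
    interchange = solve-∀

  ∑-*ˡ : (c : ℤ) (xs : List U) (g : U → ℤ) → ∑[ x ∈ xs ] (c * g x) ≡ c * ∑ xs g
  ∑-*ˡ c []       g = sym (ℤP.*-zeroʳ c)
  ∑-*ˡ c (x ∷ xs) g = trans (cong (_+_ (c * g x)) (∑-*ˡ c xs g)) (sym (ℤP.*-distribˡ-+ c (g x) _))

  ∑-zero : (xs : List U) → ∑[ x ∈ xs ] + 0 ≡ + 0
  ∑-zero []       = refl
  ∑-zero (x ∷ xs) = trans (ℤP.+-identityˡ _) (∑-zero xs)

  ∑-↭ : {xs ys : List U} (g : U → ℤ) → xs ↭ ys → ∑ xs g ≡ ∑ ys g
  ∑-↭ g xs↭ys = PermutationSetoid.foldr-commMonoid (setoid ℤ) ℤP.+-0-isCommutativeMonoid (↭⇒↭ₛ (map⁺ g xs↭ys))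

  concatMap-unique : (F : U → List V) {xs : List U} → Unique xs →
    (∀ {x} → x ∈ xs → Unique (F x)) →
    (∀ {x x′ z} → x ∈ xs → x′ ∈ xs → z ∈ F x → z ∈ F x′ → x ≡ x′) →
    Unique (concatMap F xs)
  concatMap-unique F {[]}     _            _  _        = []
  concatMap-unique F {x ∷ xs} (x∉xs ∷ xs!) F! disjoint =
    Unique.++⁺ (F! (here refl)) (concatMap-unique F xs! (F! ∘ there) (λ p q → disjoint (there p) (there q)))
      apart
    where
    apart : Disjoint (F x) (concatMap F xs)
    apart (z∈Fx , z∈rest) with x′ , x′∈xs , z∈Fx′ ← find (∈-concatMap⁻ F z∈rest) =
      All.lookup x∉xs x′∈xs (disjoint (here refl) (there x′∈xs) z∈Fx z∈Fx′)

  ∑-fibres : (g : V → ℤ) (F : U → List V) {xs : List U} {ys : List V} →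
    Unique xs → Unique ys → (∀ {x} → x ∈ xs → Unique (F x)) →
    (∀ {x x′ z} → x ∈ xs → x′ ∈ xs → z ∈ F x → z ∈ F x′ → x ≡ x′) →
    (∀ {z} → z ∈ ys → ∃[ x ] x ∈ xs × z ∈ F x) →
    (∀ {x z} → x ∈ xs → z ∈ F x → z ∈ ys) →
    ∑ ys g ≡ ∑[ x ∈ xs ] ∑ (F x) g
  ∑-fibres g F {xs} {ys} xs! ys! F! disjoint covered inside = begin
    ∑ ys g                ≡⟨ ∑-↭ g (∼bag⇒↭ (unique∧set⇒bag ys! (concatMap-unique F xs! F! disjoint) (mk⇔ to from))) ⟩
    ∑ (concatMap F xs) g  ≡⟨ ∑-concatMap F xs g ⟩
    ∑[ x ∈ xs ] ∑ (F x) g ∎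
    where
    open ≡-Reasoning
    to : ∀ {z} → z ∈ ys → z ∈ concatMap F xs
    to z∈ys with x , x∈xs , z∈Fx ← covered z∈ys = ∈-concatMap⁺ F (lose x∈xs z∈Fx)
    from : ∀ {z} → z ∈ concatMap F xs → z ∈ ys
    from z∈ with x , x∈xs , z∈Fx ← find (∈-concatMap⁻ F z∈) = inside x∈xs z∈Fx

  ∑< : ℕ → (ℕ → ℤ) → ℤ
  ∑< zero    f = + 0
  ∑< (suc n) f = f 0 + ∑< n (f ∘ suc)

  infix 5 ∑<
  syntax ∑< n (λ i → e) = ∑[ i < n ] e

  ∑-applyUpTo : (f : ℕ → U) (n : ℕ) (g : U → ℤ) → ∑ (applyUpTo f n) g ≡ ∑< n (g ∘ f)
  ∑-applyUpTo f zero    g = refl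
  ∑-applyUpTo f (suc n) g = cong (_+_ (g (f 0))) (∑-applyUpTo (f ∘ suc) n g)

  ∑-upTo : (n : ℕ) (g : ℕ → ℤ) → ∑ (upTo n) g ≡ ∑< n g
  ∑-upTo = ∑-applyUpTo id

  ∑<-cong : (n : ℕ) {f g : ℕ → ℤ} → (∀ {i} → i < n → f i ≡ g i) → ∑< n f ≡ ∑< n g
  ∑<-cong zero    eq = refl
  ∑<-cong (suc n) eq = cong₂ _+_ (eq z<s) (∑<-cong n (eq ∘ s<s))

  ∑<-*ˡ : (n : ℕ) (c : ℤ) (f : ℕ → ℤ) → ∑[ i < n ] (c * f i) ≡ c * ∑< n f
  ∑<-*ˡ zero    c f = sym (ℤP.*-zeroʳ c)
  ∑<-*ˡ (suc n) c f = trans (cong (_+_ (c * f 0)) (∑<-*ˡ n c (f ∘ suc))) (sym (ℤP.*-distribˡ-+ c (f 0) _))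

  ∑<-zero : (n : ℕ) → ∑[ i < n ] + 0 ≡ + 0
  ∑<-zero zero    = refl
  ∑<-zero (suc n) = trans (ℤP.+-identityˡ _) (∑<-zero n)

  ∑<-diff : (n : ℕ) (f g : ℕ → ℤ) → ∑< n f - ∑< n g ≡ ∑[ i < n ] (f i - g i)
  ∑<-diff zero    f g = refl
  ∑<-diff (suc n) f g = trans (interchange (f 0) (∑< n (f ∘ suc)) (g 0) (∑< n (g ∘ suc)))
                          (cong (_+_ (f 0 - g 0)) (∑<-diff n (f ∘ suc) (g ∘ suc)))
    where
    interchange : ∀ a b c d → (a + b) - (c + d) ≡ (a - c) + (b - d)
    interchange = solve-∀

  -- Power series as coefficient sequences

  Seq : Set
  Seq = ℕ → ℤ

  -- On coefficient sequences, partialSums is multiplication by 1/(1 - t) and Δ by 1 - t.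
  partialSums : Seq → Seq
  partialSums f zero    = f zero
  partialSums f (suc m) = partialSums f m + f (suc m)

  partialSums^ : ℕ → Seq → Seq
  partialSums^ zero    f = f
  partialSums^ (suc D) f = partialSums (partialSums^ D f)

  Δ : Seq → Seq
  Δ f zero    = f zero
  Δ f (suc i) = f (suc i) - f i

  Δ^ : ℕ → Seq → Seq
  Δ^ zero    f = f
  Δ^ (suc j) f = Δ (Δ^ j f)

  shift : Seq → Seq
  shift f zero    = + 0
  shift f (suc i) = f i

  partialSums-cong : {f g : Seq} → f ≗ g → partialSums f ≗ partialSums g
  partialSums-cong eq zero    = eq zero
  partialSums-cong eq (suc m) = cong₂ _+_ (partialSums-cong eq m) (eq (suc m))

  partialSums^-cong : (D : ℕ) {f g : Seq} → f ≗ g → partialSums^ D f ≗ partialSums^ D g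
  partialSums^-cong zero    eq = eq
  partialSums^-cong (suc D) eq = partialSums-cong (partialSums^-cong D eq)

  partialSums-injective : {f g : Seq} → partialSums f ≗ partialSums g → f ≗ g
  partialSums-injective eq zero    = eq zero
  partialSums-injective {f} {g} eq (suc m) =
    ∙-cancelˡ (partialSums f m) (f (suc m)) (g (suc m))
      (trans (eq (suc m)) (cong (_+ g (suc m)) (sym (eq m))))

  partialSums^-injective : (D : ℕ) {f g : Seq} → partialSums^ D f ≗ partialSums^ D g → f ≗ g
  partialSums^-injective zero    eq = eq
  partialSums^-injective (suc D) eq = partialSums^-injective D (partialSums-injective eq)

  partialSums-∑ : (xs : List U) (F : U → Seq) →
    partialSums (λ i → ∑[ x ∈ xs ] F x i) ≗ (λ m → ∑[ x ∈ xs ] partialSums (F x) m)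
  partialSums-∑ xs F zero    = refl
  partialSums-∑ xs F (suc m) =
    trans (cong (_+ (∑[ x ∈ xs ] F x (suc m))) (partialSums-∑ xs F m))
          (sym (∑-+ xs (λ x → partialSums (F x) m) (λ x → F x (suc m))))

  partialSums^-∑ : (D : ℕ) (xs : List U) (F : U → Seq) →
    partialSums^ D (λ i → ∑[ x ∈ xs ] F x i) ≗ (λ m → ∑[ x ∈ xs ] partialSums^ D (F x) m)
  partialSums^-∑ zero    xs F m = refl
  partialSums^-∑ (suc D) xs F m =
    trans (partialSums-cong (partialSums^-∑ D xs F) m) (partialSums-∑ xs (partialSums^ D ∘ F) m)

  partialSums-*ˡ : (c : ℤ) (f : Seq) → partialSums (λ i → c * f i) ≗ (λ m → c * partialSums f m)
  partialSums-*ˡ c f zero    = refl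
  partialSums-*ˡ c f (suc m) =
    trans (cong (_+ c * f (suc m)) (partialSums-*ˡ c f m)) (sym (ℤP.*-distribˡ-+ c _ _))

  partialSums^-*ˡ : (D : ℕ) (c : ℤ) (f : Seq) → partialSums^ D (λ i → c * f i) ≗ (λ m → c * partialSums^ D f m)
  partialSums^-*ˡ zero    c f m = refl
  partialSums^-*ˡ (suc D) c f m =
    trans (partialSums-cong (partialSums^-*ˡ D c f) m) (partialSums-*ˡ c (partialSums^ D f) m)

  partialSums-telescope : (F : Seq) → partialSums (λ i → F (suc i) - F i) ≗ (λ m → F (suc m) - F 0)
  partialSums-telescope F zero    = refl
  partialSums-telescope F (suc m) = trans (cong (_+ (F (suc (suc m)) - F (suc m))) (partialSums-telescope F m))
                                          (collapse (F 0) (F (suc m)) (F (suc (suc m))))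
    where
    collapse : ∀ a b c → (b - a) + (c - b) ≡ c - a
    collapse = solve-∀

  partialSums-Δ : (f : Seq) → partialSums (Δ f) ≗ f
  partialSums-Δ f zero    = refl
  partialSums-Δ f (suc m) = trans (cong (_+ Δ f (suc m)) (partialSums-Δ f m)) (collapse (f m) (f (suc m)))
    where
    collapse : ∀ a b → a + (b - a) ≡ b
    collapse = solve-∀

  partialSums^-partialSums : (D : ℕ) (f : Seq) → partialSums^ D (partialSums f) ≗ partialSums (partialSums^ D f)
  partialSums^-partialSums zero    f m = refl
  partialSums^-partialSums (suc D) f   = partialSums-cong (partialSums^-partialSums D f)

  partialSums^-Δ^ : (D j : ℕ) (f : Seq) → partialSums^ (j ℕ.+ D) (Δ^ j f) ≗ partialSums^ D f
  partialSums^-Δ^ D zero    f m = refl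
  partialSums^-Δ^ D (suc j) f m = begin
    partialSums (partialSums^ (j ℕ.+ D) (Δ (Δ^ j f))) m ≡⟨ partialSums^-partialSums (j ℕ.+ D) (Δ (Δ^ j f)) m ⟨
    partialSums^ (j ℕ.+ D) (partialSums (Δ (Δ^ j f))) m ≡⟨ partialSums^-cong (j ℕ.+ D) (partialSums-Δ (Δ^ j f)) m ⟩
    partialSums^ (j ℕ.+ D) (Δ^ j f) m                   ≡⟨ partialSums^-Δ^ D j f m ⟩
    partialSums^ D f m                                  ∎
    where open ≡-Reasoning

  partialSums-shift : (f : Seq) → partialSums (shift f) ≗ shift (partialSums f)
  partialSums-shift f zero          = refl
  partialSums-shift f (suc zero)    = ℤP.+-identityˡ (f 0)
  partialSums-shift f (suc (suc m)) = cong (_+ f (suc m)) (partialSums-shift f (suc m))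

  partialSums^-shift : (D : ℕ) (f : Seq) → partialSums^ D (shift f) ≗ shift (partialSums^ D f)
  partialSums^-shift zero    f i = refl
  partialSums^-shift (suc D) f i =
    trans (partialSums-cong (partialSums^-shift D f) i) (partialSums-shift (partialSums^ D f) i)

  horner : ℕ → Seq → ℤ → ℤ
  horner zero    f t = f 0
  horner (suc D) f t = f 0 + t * horner D (f ∘ suc) t

  VanishesAbove : ℕ → Seq → Set
  VanishesAbove D f = ∀ {i} → D < i → f i ≡ + 0

  horner-cong : (D : ℕ) {f g : Seq} (t : ℤ) → f ≗ g → horner D f t ≡ horner D g t
  horner-cong zero    t eq = eq 0
  horner-cong (suc D) t eq = cong₂ (λ a b → a + t * b) (eq 0) (horner-cong D t (eq ∘ suc))

  horner-∑ : (D : ℕ) (xs : List U) (F : U → Seq) (t : ℤ) →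
    horner D (λ i → ∑[ x ∈ xs ] F x i) t ≡ ∑[ x ∈ xs ] horner D (F x) t
  horner-∑ zero    xs F t = refl
  horner-∑ (suc D) xs F t = begin
    (∑[ x ∈ xs ] F x 0) + t * horner D (λ i → ∑[ x ∈ xs ] F x (suc i)) t
      ≡⟨ cong (λ h → (∑[ x ∈ xs ] F x 0) + t * h) (horner-∑ D xs (λ x → F x ∘ suc) t) ⟩
    (∑[ x ∈ xs ] F x 0) + t * (∑[ x ∈ xs ] horner D (F x ∘ suc) t)
      ≡⟨ cong (_+_ (∑[ x ∈ xs ] F x 0)) (∑-*ˡ t xs (λ x → horner D (F x ∘ suc) t)) ⟨
    (∑[ x ∈ xs ] F x 0) + (∑[ x ∈ xs ] t * horner D (F x ∘ suc) t)
      ≡⟨ ∑-+ xs (λ x → F x 0) (λ x → t * horner D (F x ∘ suc) t) ⟨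
    ∑[ x ∈ xs ] horner (suc D) (F x) t ∎
    where open ≡-Reasoning

  horner-*ˡ : (D : ℕ) (c : ℤ) (f : Seq) (t : ℤ) → horner D (λ i → c * f i) t ≡ c * horner D f t
  horner-*ˡ zero    c f t = refl
  horner-*ˡ (suc D) c f t =
    trans (cong (λ h → c * f 0 + t * h) (horner-*ˡ D c (f ∘ suc) t)) (factor c (f 0) t (horner D (f ∘ suc) t))
    where
    factor : ∀ c a t h → c * a + t * (c * h) ≡ c * (a + t * h)
    factor = solve-∀

  horner-zero : (D : ℕ) (t : ℤ) → horner D (λ _ → + 0) t ≡ + 0
  horner-zero zero    t = refl
  horner-zero (suc D) t = trans (cong (λ h → + 0 + t * h) (horner-zero D t)) (trans (ℤP.+-identityˡ _) (ℤP.*-zeroʳ t))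

  horner-diff : (D : ℕ) (f g : Seq) (t : ℤ) → horner D (λ i → f i - g i) t ≡ horner D f t - horner D g t
  horner-diff zero    f g t = refl
  horner-diff (suc D) f g t =
    trans (cong (λ h → f 0 - g 0 + t * h) (horner-diff D (f ∘ suc) (g ∘ suc) t))
          (distrib (f 0) (g 0) t (horner D (f ∘ suc) t) (horner D (g ∘ suc) t))
    where
    distrib : ∀ a b t x y → a - b + t * (x - y) ≡ (a + t * x) - (b + t * y)
    distrib = solve-∀

  horner-extend : (D : ℕ) (f : Seq) (t : ℤ) → VanishesAbove D f → horner (suc D) f t ≡ horner D f t
  horner-extend zero    f t f≈0 =
    trans (cong (λ a → f 0 + t * a) (f≈0 z<s)) (trans (cong (_+_ (f 0)) (ℤP.*-zeroʳ t)) (ℤP.+-identityʳ (f 0)))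
  horner-extend (suc D) f t f≈0 = cong (λ h → f 0 + t * h) (horner-extend D (f ∘ suc) t (f≈0 ∘ s<s))

  Δ-vanishesAbove : (D : ℕ) (f : Seq) → VanishesAbove D f → VanishesAbove (suc D) (Δ f)
  Δ-vanishesAbove D f f≈0 {suc i} (s<s D<i) =
    cong₂ _-_ (f≈0 (ℕP.m<n⇒m<1+n D<i)) (f≈0 D<i)

  Δ^-vanishesAbove : (D j : ℕ) (f : Seq) → VanishesAbove D f → VanishesAbove (j ℕ.+ D) (Δ^ j f)
  Δ^-vanishesAbove D zero    f f≈0 = f≈0
  Δ^-vanishesAbove D (suc j) f f≈0 = Δ-vanishesAbove (j ℕ.+ D) (Δ^ j f) (Δ^-vanishesAbove D j f f≈0)

  horner-Δ : (D : ℕ) (f : Seq) (t : ℤ) → VanishesAbove D f → horner (suc D) (Δ f) t ≡ (+ 1 - t) * horner D f t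
  horner-Δ D f t f≈0 = begin
    f 0 + t * horner D (λ i → f (suc i) - f i) t      ≡⟨ cong (λ h → f 0 + t * h) (horner-diff D (f ∘ suc) f t) ⟩
    f 0 + t * (horner D (f ∘ suc) t - horner D f t)   ≡⟨ regroup (f 0) t (horner D (f ∘ suc) t) (horner D f t) ⟩
    horner (suc D) f t - t * horner D f t             ≡⟨ cong (λ h → h - t * horner D f t) (horner-extend D f t f≈0) ⟩
    horner D f t - t * horner D f t                   ≡⟨ factor t (horner D f t) ⟩
    (+ 1 - t) * horner D f t                          ∎
    where
    open ≡-Reasoning
    regroup : ∀ a t x y → a + t * (x - y) ≡ (a + t * x) - t * y
    regroup = solve-∀
    factor : ∀ t y → y - t * y ≡ (+ 1 - t) * y
    factor = solve-∀

  horner-Δ^ : (D j : ℕ) (f : Seq) (t : ℤ) → VanishesAbove D f →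
    horner (j ℕ.+ D) (Δ^ j f) t ≡ (+ 1 - t) ^ j * horner D f t
  horner-Δ^ D zero    f t f≈0 = sym (ℤP.*-identityˡ _)
  horner-Δ^ D (suc j) f t f≈0 = begin
    horner (suc (j ℕ.+ D)) (Δ (Δ^ j f)) t  ≡⟨ horner-Δ (j ℕ.+ D) (Δ^ j f) t (Δ^-vanishesAbove D j f f≈0) ⟩
    (+ 1 - t) * horner (j ℕ.+ D) (Δ^ j f) t ≡⟨ cong ((+ 1 - t) *_) (horner-Δ^ D j f t f≈0) ⟩
    (+ 1 - t) * ((+ 1 - t) ^ j * horner D f t) ≡⟨ ℤP.*-assoc (+ 1 - t) _ _ ⟨
    (+ 1 - t) ^ suc j * horner D f t       ∎
    where open ≡-Reasoning

  δ : ℕ → Seq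
  δ zero    zero    = + 1
  δ zero    (suc i) = + 0
  δ (suc d)         = shift (δ d)

  δ-vanishesAbove : {d D : ℕ} → d ≤ D → VanishesAbove D (δ d)
  δ-vanishesAbove {zero}  z≤n       {suc i} _         = refl
  δ-vanishesAbove {suc d} (s≤s d≤D) {suc i} (s<s D<i) = δ-vanishesAbove d≤D D<i

  horner-δ : (D d : ℕ) (t : ℤ) → d ≤ D → horner D (δ d) t ≡ t ^ d
  horner-δ zero    zero    t _         = refl
  horner-δ (suc D) zero    t _         =
    trans (cong (λ h → + 1 + t * h) (horner-zero D t)) (cong (_+_ (+ 1)) (ℤP.*-zeroʳ t))
  horner-δ (suc D) (suc d) t (s≤s d≤D) = trans (ℤP.+-identityˡ _) (cong (t *_) (horner-δ D d t d≤D))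

  -- Negative binomial coefficients

  -- negBinom D j = (D + j choose j), the coefficient of tʲ in (1 - t)^-(D+1).
  negBinom : ℕ → ℕ → ℕ
  negBinom zero    j       = 1
  negBinom (suc D) zero    = 1
  negBinom (suc D) (suc j) = negBinom (suc D) j ℕ.+ negBinom D (suc j)

  -- negBinomFrom D d m is the coefficient of tᵐ in tᵈ (1 - t)^-(D+1).
  negBinomFrom : ℕ → ℕ → ℕ → ℕ
  negBinomFrom D zero    m       = negBinom D m
  negBinomFrom D (suc d) zero    = 0
  negBinomFrom D (suc d) (suc m) = negBinomFrom D d m

  negBinom-zeroʳ : (D : ℕ) → negBinom D 0 ≡ 1
  negBinom-zeroʳ zero    = refl
  negBinom-zeroʳ (suc D) = refl

  negBinom-oneʳ : (D : ℕ) → negBinom D 1 ≡ suc D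
  negBinom-oneʳ zero    = refl
  negBinom-oneʳ (suc D) = cong suc (negBinom-oneʳ D)

  partialSums-negBinom : (D : ℕ) → partialSums (λ j → + negBinom D j) ≗ (λ j → + negBinom (suc D) j)
  partialSums-negBinom D zero    = cong +_ (negBinom-zeroʳ D)
  partialSums-negBinom D (suc j) = cong (_+ + negBinom D (suc j)) (partialSums-negBinom D j)

  partialSums^-δ₀ : (D : ℕ) → partialSums^ (suc D) (δ 0) ≗ (λ m → + negBinom D m)
  partialSums^-δ₀ zero    zero    = refl
  partialSums^-δ₀ zero    (suc m) = cong (_+ + 0) (partialSums^-δ₀ zero m)
  partialSums^-δ₀ (suc D) m       = trans (partialSums-cong (partialSums^-δ₀ D) m) (partialSums-negBinom D m)

  partialSums^-δ : (D d : ℕ) → partialSums^ (suc D) (δ d) ≗ (λ m → + negBinomFrom D d m)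
  partialSums^-δ D zero    m       = partialSums^-δ₀ D m
  partialSums^-δ D (suc d) zero    = partialSums^-shift (suc D) (δ d) zero
  partialSums^-δ D (suc d) (suc m) = trans (partialSums^-shift (suc D) (δ d) (suc m)) (partialSums^-δ D d m)

  negBinom-absorb : (D j : ℕ) → suc D ℕ.* negBinom (suc D) j ≡ suc j ℕ.* negBinom D (suc j)
  negBinom-absorb D zero = begin
    suc D ℕ.* 1        ≡⟨ ℕP.*-identityʳ (suc D) ⟩
    suc D              ≡⟨ negBinom-oneʳ D ⟨
    negBinom D 1       ≡⟨ ℕP.*-identityˡ _ ⟨
    1 ℕ.* negBinom D 1 ∎
    where open ≡-Reasoning
  negBinom-absorb zero (suc j) = begin
    1 ℕ.* (negBinom 1 j ℕ.+ 1)   ≡⟨ ℕP.*-identityˡ _ ⟩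
    negBinom 1 j ℕ.+ 1           ≡⟨ cong (ℕ._+ 1) (trans (sym (ℕP.*-identityˡ _)) (negBinom-absorb zero j)) ⟩
    suc j ℕ.* 1 ℕ.+ 1            ≡⟨ count j ⟩
    suc (suc j) ℕ.* 1            ∎
    where
    open ≡-Reasoning
    count : ∀ j → suc j ℕ.* 1 ℕ.+ 1 ≡ suc (suc j) ℕ.* 1
    count = solveℕ-∀
  negBinom-absorb (suc D) (suc j) = begin
    suc (suc D) ℕ.* (X ℕ.+ Y)                        ≡⟨ ℕP.*-distribˡ-+ (suc (suc D)) X Y ⟩
    suc (suc D) ℕ.* X ℕ.+ suc (suc D) ℕ.* Y          ≡⟨ cong (ℕ._+ suc (suc D) ℕ.* Y) (negBinom-absorb (suc D) j) ⟩
    suc j ℕ.* Y ℕ.+ suc (suc D) ℕ.* Y                ≡⟨ regroup j D Y ⟩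
    suc (suc j) ℕ.* Y ℕ.+ suc D ℕ.* Y                ≡⟨ cong (suc (suc j) ℕ.* Y ℕ.+_) (negBinom-absorb D (suc j)) ⟩
    suc (suc j) ℕ.* Y ℕ.+ suc (suc j) ℕ.* Z          ≡⟨ ℕP.*-distribˡ-+ (suc (suc j)) Y Z ⟨
    suc (suc j) ℕ.* negBinom (suc D) (suc (suc j))   ∎
    where
    open ≡-Reasoning
    X = negBinom (suc (suc D)) j
    Y = negBinom (suc D) (suc j)
    Z = negBinom D (suc (suc j))
    regroup : ∀ j D Y → suc j ℕ.* Y ℕ.+ suc (suc D) ℕ.* Y ≡ suc (suc j) ℕ.* Y ℕ.+ suc D ℕ.* Y
    regroup = solveℕ-∀

  negBinomFrom-pascal : (D d m : ℕ) →
    negBinomFrom (suc D) d m ≡ negBinomFrom (suc D) (suc d) m ℕ.+ negBinomFrom D d m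
  negBinomFrom-pascal D zero    zero    = sym (negBinom-zeroʳ D)
  negBinomFrom-pascal D zero    (suc m) = refl
  negBinomFrom-pascal D (suc d) zero    = refl
  negBinomFrom-pascal D (suc d) (suc m) = negBinomFrom-pascal D d m

  negBinomFrom-insertMax : (n d m : ℕ) → d ≤ n →
    suc d ℕ.* negBinomFrom (suc n) d m ℕ.+ (n ∸ d) ℕ.* negBinomFrom (suc n) (suc d) m
      ≡ suc m ℕ.* negBinomFrom n d m
  negBinomFrom-insertMax n zero zero _
    rewrite ℕP.*-zeroʳ n | negBinom-zeroʳ n = refl
  negBinomFrom-insertMax n zero (suc j) _ = begin
    1 ℕ.* (X ℕ.+ Y) ℕ.+ n ℕ.* X   ≡⟨ regroup n X Y ⟩
    suc n ℕ.* X ℕ.+ Y             ≡⟨ cong (ℕ._+ Y) (negBinom-absorb n j) ⟩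
    suc j ℕ.* Y ℕ.+ Y             ≡⟨ ℕP.+-comm (suc j ℕ.* Y) Y ⟩
    suc (suc j) ℕ.* Y             ∎
    where
    open ≡-Reasoning
    X = negBinom (suc n) j
    Y = negBinom n (suc j)
    regroup : ∀ n X Y → 1 ℕ.* (X ℕ.+ Y) ℕ.+ n ℕ.* X ≡ suc n ℕ.* X ℕ.+ Y
    regroup = solveℕ-∀
  negBinomFrom-insertMax n (suc d) zero _
    rewrite ℕP.*-zeroʳ (suc (suc d)) | ℕP.*-zeroʳ (n ∸ suc d) = refl
  negBinomFrom-insertMax n (suc d) (suc m) d<n = begin
    suc (suc d) ℕ.* X ℕ.+ a ℕ.* Y                  ≡⟨ split d a X Y ⟩
    suc d ℕ.* X ℕ.+ X ℕ.+ a ℕ.* Y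
      ≡⟨ cong (λ x → suc d ℕ.* X ℕ.+ x ℕ.+ a ℕ.* Y) (negBinomFrom-pascal n d m) ⟩
    suc d ℕ.* X ℕ.+ (Y ℕ.+ Z) ℕ.+ a ℕ.* Y          ≡⟨ regroup d a X Y Z ⟩
    suc d ℕ.* X ℕ.+ suc a ℕ.* Y ℕ.+ Z              ≡⟨ cong (λ b → suc d ℕ.* X ℕ.+ b ℕ.* Y ℕ.+ Z) (ℕP.+-∸-assoc 1 d<n) ⟨
    suc d ℕ.* X ℕ.+ (n ∸ d) ℕ.* Y ℕ.+ Z            ≡⟨ cong (ℕ._+ Z) (negBinomFrom-insertMax n d m (ℕP.<⇒≤ d<n)) ⟩
    suc m ℕ.* Z ℕ.+ Z                              ≡⟨ ℕP.+-comm (suc m ℕ.* Z) Z ⟩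
    suc (suc m) ℕ.* Z                              ∎
    where
    open ≡-Reasoning
    a = n ∸ suc d
    X = negBinomFrom (suc n) d m
    Y = negBinomFrom (suc n) (suc d) m
    Z = negBinomFrom n d m
    split : ∀ d a X Y → suc (suc d) ℕ.* X ℕ.+ a ℕ.* Y ≡ suc d ℕ.* X ℕ.+ X ℕ.+ a ℕ.* Y
    split = solveℕ-∀
    regroup : ∀ d a X Y Z → suc d ℕ.* X ℕ.+ (Y ℕ.+ Z) ℕ.+ a ℕ.* Y ≡ suc d ℕ.* X ℕ.+ suc a ℕ.* Y ℕ.+ Z
    regroup = solveℕ-∀

  negBinomFrom-insertMaxMin : (k e m : ℕ) → e ≤ k →
    let X = negBinomFrom (suc k) e m ; Y = negBinomFrom (suc k) (suc e) m in
    suc e ℕ.* X ℕ.+ (k ∸ e) ℕ.* Y ℕ.+ (e ℕ.* X ℕ.+ (suc k ∸ e) ℕ.* Y) ≡ suc (m ℕ.+ m) ℕ.* negBinomFrom k e m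
  negBinomFrom-insertMaxMin k e m e≤k = ℕP.+-cancelʳ-≡ Z _ _ (begin
    P ℕ.+ (e ℕ.* X ℕ.+ (suc k ∸ e) ℕ.* Y) ℕ.+ Z   ≡⟨ cong (λ c → P ℕ.+ (e ℕ.* X ℕ.+ c ℕ.* Y) ℕ.+ Z) (ℕP.+-∸-assoc 1 e≤k) ⟩
    P ℕ.+ (e ℕ.* X ℕ.+ suc a ℕ.* Y) ℕ.+ Z         ≡⟨ regroup P e a X Y Z ⟩
    P ℕ.+ (e ℕ.* X ℕ.+ a ℕ.* Y ℕ.+ (Y ℕ.+ Z))
      ≡⟨ cong (λ x → P ℕ.+ (e ℕ.* X ℕ.+ a ℕ.* Y ℕ.+ x)) (negBinomFrom-pascal k e m) ⟨
    P ℕ.+ (e ℕ.* X ℕ.+ a ℕ.* Y ℕ.+ X)             ≡⟨ cong (P ℕ.+_) (absorbX e a X Y) ⟩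
    P ℕ.+ P                                       ≡⟨ cong₂ ℕ._+_ weightA weightA ⟩
    suc m ℕ.* Z ℕ.+ suc m ℕ.* Z                   ≡⟨ twice m Z ⟩
    suc (m ℕ.+ m) ℕ.* Z ℕ.+ Z                     ∎)
    where
    open ≡-Reasoning
    a = k ∸ e
    X = negBinomFrom (suc k) e m
    Y = negBinomFrom (suc k) (suc e) m
    Z = negBinomFrom k e m
    P = suc e ℕ.* X ℕ.+ a ℕ.* Y
    weightA : P ≡ suc m ℕ.* Z
    weightA = negBinomFrom-insertMax k e m e≤k
    regroup : ∀ P e a X Y Z → P ℕ.+ (e ℕ.* X ℕ.+ suc a ℕ.* Y) ℕ.+ Z ≡ P ℕ.+ (e ℕ.* X ℕ.+ a ℕ.* Y ℕ.+ (Y ℕ.+ Z))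
    regroup = solveℕ-∀
    absorbX : ∀ e a X Y → e ℕ.* X ℕ.+ a ℕ.* Y ℕ.+ X ≡ suc e ℕ.* X ℕ.+ a ℕ.* Y
    absorbX = solveℕ-∀
    twice : ∀ m Z → suc m ℕ.* Z ℕ.+ suc m ℕ.* Z ≡ suc (m ℕ.+ m) ℕ.* Z ℕ.+ Z
    twice = solveℕ-∀

  -- Descents under insertion of an extreme letter

  desBy : (U → U → Bool) → List U → ℕ
  desBy b []           = 0
  desBy b (x ∷ [])     = 0
  desBy b (x ∷ y ∷ xs) = (if b x y then 1 else 0) ℕ.+ desBy b (y ∷ xs)

  insertions : U → List U → List (List U)
  insertions a []       = (a ∷ []) ∷ []
  insertions a (x ∷ xs) = (a ∷ x ∷ xs) ∷ map (x ∷_) (insertions a xs)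

  desBy-∷-≤ : (b : U → U → Bool) (x : U) (xs : List U) → desBy b (x ∷ xs) ≤ length xs
  desBy-∷-≤ b x []       = z≤n
  desBy-∷-≤ b x (y ∷ xs) with b x y
  ... | true  = s≤s (desBy-∷-≤ b y xs)
  ... | false = ℕP.m≤n⇒m≤1+n (desBy-∷-≤ b y xs)

  desBy-≤ : (b : U → U → Bool) (xs : List U) → desBy b xs ≤ length xs
  desBy-≤ b []       = z≤n
  desBy-≤ b (x ∷ xs) = ℕP.m≤n⇒m≤1+n (desBy-∷-≤ b x xs)

  Above : (U → U → Bool) → U → U → Set
  Above b M z = b M z ≡ true × b z M ≡ false

  Below : (U → U → Bool) → U → U → Set
  Below b m z = b z m ≡ true × b m z ≡ false

  ∑-insertions-max-behind : (b : U → U → Bool) {M : U} (h : ℕ → ℤ) (x : U) (xs : List U) →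
    All (Above b M) (x ∷ xs) →
    let d = desBy b (x ∷ xs) in
    ∑[ w ∈ insertions M xs ] h (desBy b (x ∷ w)) ≡ + suc d * h d + + (length xs ∸ d) * h (suc d)
  ∑-insertions-max-behind b h x [] ((_ , x↛M) ∷ _) rewrite x↛M = only (h 0) (h 1)
    where
    only : ∀ a c → a + + 0 ≡ + 1 * a + + 0 * c
    only = solve-∀
  -- The recursive call runs behind y, with the indicator of the descent at (x, y) folded into h.
  ∑-insertions-max-behind b {M} h x (y ∷ ys) ((_ , x↛M) ∷ (M→y , y↛M) ∷ above)
    rewrite ∑-map (y ∷_) (insertions M ys) (λ w → h (desBy b (x ∷ w))) | x↛M | M→y
    with b x y | ∑-insertions-max-behind b (λ e → h ((if b x y then 1 else 0) ℕ.+ e)) y ys ((M→y , y↛M) ∷ above)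
  ... | true  | rest rewrite rest = descent (+ d) (h (suc d)) (h (suc (suc d))) (+ (length ys ∸ d))
    where
    d = desBy b (y ∷ ys)
    descent : ∀ d h₁ h₂ l → h₁ + ((+ 1 + d) * h₁ + l * h₂) ≡ (+ 1 + (+ 1 + d)) * h₁ + l * h₂
    descent = solve-∀
  ... | false | rest rewrite rest | ℕP.+-∸-assoc 1 (desBy-∷-≤ b y ys) =
    ascent (h d) (h (suc d)) (+ suc d) (+ (length ys ∸ d))
    where
    d = desBy b (y ∷ ys)
    ascent : ∀ h₀ h₁ a l → h₁ + (a * h₀ + l * h₁) ≡ a * h₀ + (+ 1 + l) * h₁
    ascent = solve-∀

  ∑-insertions-min-behind : (b : U → U → Bool) {m : U} (h : ℕ → ℤ) (x : U) (xs : List U) →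
    All (Below b m) (x ∷ xs) →
    let d = desBy b (x ∷ xs) in
    ∑[ w ∈ insertions m xs ] h (desBy b (x ∷ w)) ≡ + d * h d + + (suc (length xs) ∸ d) * h (suc d)
  ∑-insertions-min-behind b h x [] ((x→m , _) ∷ _) rewrite x→m = only (h 0) (h 1)
    where
    only : ∀ a c → c + + 0 ≡ + 0 * a + + 1 * c
    only = solve-∀
  ∑-insertions-min-behind b {m} h x (y ∷ ys) ((x→m , _) ∷ (y→m , m↛y) ∷ below)
    rewrite ∑-map (y ∷_) (insertions m ys) (λ w → h (desBy b (x ∷ w))) | x→m | m↛y
    with b x y | ∑-insertions-min-behind b (λ e → h ((if b x y then 1 else 0) ℕ.+ e)) y ys ((y→m , m↛y) ∷ below)
  ... | true  | rest rewrite rest = descent (+ d) (h (suc d)) (h (suc (suc d))) (+ (suc (length ys) ∸ d))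
    where
    d = desBy b (y ∷ ys)
    descent : ∀ d h₁ h₂ l → h₁ + (d * h₁ + l * h₂) ≡ (+ 1 + d) * h₁ + l * h₂
    descent = solve-∀
  ... | false | rest rewrite rest | ℕP.+-∸-assoc 1 (ℕP.m≤n⇒m≤1+n (desBy-∷-≤ b y ys)) =
    ascent (h d) (h (suc d)) (+ d) (+ (suc (length ys) ∸ d))
    where
    d = desBy b (y ∷ ys)
    ascent : ∀ h₀ h₁ a l → h₁ + (a * h₀ + l * h₁) ≡ a * h₀ + (+ 1 + l) * h₁
    ascent = solve-∀

  ∑-insertions-max : (b : U → U → Bool) {M : U} (h : ℕ → ℤ) (xs : List U) → All (Above b M) xs →
    let d = desBy b xs in
    ∑[ w ∈ insertions M xs ] h (desBy b w) ≡ + suc d * h d + + (length xs ∸ d) * h (suc d)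
  ∑-insertions-max b h [] _ = only (h 0) (h 1)
    where
    only : ∀ a c → a + + 0 ≡ + 1 * a + + 0 * c
    only = solve-∀
  ∑-insertions-max b {M} h (x ∷ xs) ((M→x , x↛M) ∷ above)
    rewrite ∑-map (x ∷_) (insertions M xs) (λ w → h (desBy b w)) | M→x
          | ∑-insertions-max-behind b h x xs ((M→x , x↛M) ∷ above)
          | ℕP.+-∸-assoc 1 (desBy-∷-≤ b x xs) = ascent (h d) (h (suc d)) (+ suc d) (+ (length xs ∸ d))
    where
    d = desBy b (x ∷ xs)
    ascent : ∀ h₀ h₁ a l → h₁ + (a * h₀ + l * h₁) ≡ a * h₀ + (+ 1 + l) * h₁
    ascent = solve-∀

  Unique-resp-↭ : {xs ys : List U} → xs ↭ ys → Unique xs → Unique ys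
  Unique-resp-↭ {U = U} xs↭ys = PermutationSetoid.Unique-resp-↭ (setoid U) (↭⇒↭ₛ xs↭ys)

  ∈-insertions⇒↭ : {a : U} (xs : List U) {w : List U} → w ∈ insertions a xs → w ↭ a ∷ xs
  ∈-insertions⇒↭ []       (here refl) = ↭-refl
  ∈-insertions⇒↭ (x ∷ xs) (here refl) = ↭-refl
  ∈-insertions⇒↭ {a = a} (x ∷ xs) (there w∈) with w′ , w′∈ , refl ← ∈-map⁻ (x ∷_) w∈ =
    ↭-trans (↭-prep x (∈-insertions⇒↭ xs w′∈)) (↭-swap x a ↭-refl)

  ∈-insertions : {a : U} (ys zs : List U) → ys ++ a ∷ zs ∈ insertions a (ys ++ zs)
  ∈-insertions []       []       = here refl
  ∈-insertions []       (z ∷ zs) = here refl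
  ∈-insertions (y ∷ ys) zs       = there (∈-map⁺ (y ∷_) (∈-insertions ys zs))

  insertions-unique : {a : U} (xs : List U) → a ∉ xs → Unique (insertions a xs)
  insertions-unique           []       _  = [] ∷ []
  insertions-unique {a = a} (x ∷ xs) a∉ =
    All.tabulate (λ w∈ eq → let _ , _ , w≡ = ∈-map⁻ (x ∷_) w∈ in a∉ (here (∷-injectiveˡ (trans eq w≡))))
    ∷ Unique.map⁺ ∷-injectiveʳ (insertions-unique xs (a∉ ∘ there))

  module _ (_≟_ : DecidableEquality U) where

    private
      delete : U → List U → List U
      delete a []       = []
      delete a (y ∷ ys) with a ≟ y
      ... | yes _ = ys
      ... | no  _ = y ∷ delete a ys

      delete-insertions : {a : U} (xs : List U) {w : List U} → a ∉ xs → w ∈ insertions a xs → delete a w ≡ xs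
      delete-insertions {a = a} []       _ (here refl) with a ≟ a
      ... | yes _   = refl
      ... | no  a≢a = ⊥-elim (a≢a refl)
      delete-insertions {a = a} (x ∷ xs) _ (here refl) with a ≟ a
      ... | yes _   = refl
      ... | no  a≢a = ⊥-elim (a≢a refl)
      delete-insertions {a = a} (x ∷ xs) a∉ (there w∈) with w′ , w′∈ , refl ← ∈-map⁻ (x ∷_) w∈ | a ≟ x
      ... | yes a≡x = ⊥-elim (a∉ (here a≡x))
      ... | no  _   = cong (x ∷_) (delete-insertions xs (a∉ ∘ there) w′∈)

    insertions-injective : {a : U} {xs ys w : List U} → a ∉ xs → a ∉ ys →
      w ∈ insertions a xs → w ∈ insertions a ys → xs ≡ ys
    insertions-injective {xs = xs} {ys} a∉xs a∉ys w∈xs w∈ys =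
      trans (sym (delete-insertions xs a∉xs w∈xs)) (delete-insertions ys a∉ys w∈ys)

  -- Permutations and signed permutations

  ∈-words⁻ : (m : ℕ) (alph : List U) {w : List U} → w ∈ words m alph → length w ≡ m × All (_∈ alph) w
  ∈-words⁻ zero    alph (here refl) = refl , []
  ∈-words⁻ (suc m) alph w∈
    with a , a∈ , aw′∈ ← find (∈-concatMap⁻ (λ a → map (a ∷_) (words m alph)) {xs = alph} w∈)
    with w′ , w′∈ , refl ← ∈-map⁻ (a ∷_) aw′∈
    with len , letters ← ∈-words⁻ m alph w′∈ = cong suc len , a∈ ∷ letters

  ∈-words⁺ : (alph : List U) {w : List U} → All (_∈ alph) w → w ∈ words (length w) alph
  ∈-words⁺ alph []                  = here refl
  ∈-words⁺ alph {a ∷ w} (a∈ ∷ letters) =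
    ∈-concatMap⁺ (λ a → map (a ∷_) (words (length w) alph)) (lose a∈ (∈-map⁺ (a ∷_) (∈-words⁺ alph letters)))

  words-unique : (m : ℕ) {alph : List U} → Unique alph → Unique (words m alph)
  words-unique zero    alph! = [] ∷ []
  words-unique (suc m) {alph} alph! =
    concatMap-unique (λ a → map (a ∷_) (words m alph)) alph!
      (λ _ → Unique.map⁺ ∷-injectiveʳ (words-unique m alph!))
      (λ {a} {a′} _ _ w∈ w∈′ → let _ , _ , w≡ = ∈-map⁻ (a ∷_) w∈ ; _ , _ , w≡′ = ∈-map⁻ (a′ ∷_) w∈′ in
         ∷-injectiveˡ (trans (sym w≡) w≡′))

  Unique⇒distinct : (w : List ℕ) → Unique w → distinct w ≡ true
  Unique⇒distinct []       []          = refl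
  Unique⇒distinct (x ∷ w) (x∉w ∷ w!) = cong₂ _∧_ (notElem-true w x∉w) (Unique⇒distinct w w!)
    where
    notElem-true : (xs : List ℕ) → All (x ≢_) xs → notElem x xs ≡ true
    notElem-true []       []          = refl
    notElem-true (y ∷ ys) (x≢y ∷ x∉) with x ℕP.≟ y
    ... | yes x≡y = contradiction x≡y x≢y
    ... | no  _   = notElem-true ys x∉

  distinct⇒Unique : (w : List ℕ) → distinct w ≡ true → Unique w
  distinct⇒Unique []      _ = []
  distinct⇒Unique (x ∷ w) _ with notElem x w in x∉w | distinct w in w!
  ... | true | true = notElem-true⇒∉ w x∉w ∷ distinct⇒Unique w w!
    where
    notElem-true⇒∉ : (xs : List ℕ) → notElem x xs ≡ true → All (x ≢_) xs
    notElem-true⇒∉ []       _ = []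
    notElem-true⇒∉ (y ∷ ys) e with x ℕP.≟ y
    ... | no x≢y = x≢y ∷ notElem-true⇒∉ ys e

  InRange : ℕ → ℕ → Set
  InRange n x = 1 ≤ x × x ≤ n

  ∈-range⁻ : (n : ℕ) {x : ℕ} → x ∈ range n → InRange n x
  ∈-range⁻ n x∈ with y , y∈ , refl ← ∈-map⁻ suc x∈ = s≤s z≤n , ∈-upTo⁻ y∈

  ∈-range⁺ : (n : ℕ) {x : ℕ} → InRange n x → x ∈ range n
  ∈-range⁺ n {suc y} (_ , y<n) = ∈-map⁺ suc (∈-upTo⁺ y<n)

  range-unique : (n : ℕ) → Unique (range n)
  range-unique n = Unique.map⁺ ℕP.suc-injective (Unique.upTo⁺ n)

  All-InRange-shrink : {n : ℕ} {xs : List ℕ} → All (suc n ≢_) xs → All (InRange (suc n)) xs → All (InRange n) xs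
  All-InRange-shrink []              []                       = []
  All-InRange-shrink (sn≢x ∷ sn≢xs) ((1≤x , x≤sn) ∷ inRange) =
    (1≤x , ℕP.≤-pred (ℕP.≤∧≢⇒< x≤sn (sn≢x ∘ sym))) ∷ All-InRange-shrink sn≢xs inRange

  ∉⇒All≢ : {x : U} {xs : List U} → x ∉ xs → All (x ≢_) xs
  ∉⇒All≢ x∉ = All.tabulate (λ y∈ x≡y → x∉ (subst (_∈ _) (sym x≡y) y∈))

  pigeonhole : (n : ℕ) {w : List ℕ} → Unique w → All (InRange n) w → length w ≤ n
  pigeonhole zero    {[]}    _ _                   = z≤n
  pigeonhole zero    {x ∷ w} _ ((1≤x , x≤0) ∷ _) = contradiction (ℕP.≤-trans 1≤x x≤0) λ ()
  pigeonhole (suc n) {w} w! inRange with suc n ∈? w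
  ... | no  sn∉w = ℕP.m≤n⇒m≤1+n (pigeonhole n w! (All-InRange-shrink (∉⇒All≢ sn∉w) inRange))
  ... | yes sn∈w with ys , zs , refl ← ∈-∃++ sn∈w
                 with sn∉rest ∷ rest! ← Unique-resp-↭ (↭-shift (suc n) ys zs) w!
                 with _ ∷ restInRange ← All-resp-↭ (↭-shift (suc n) ys zs) inRange =
    subst (_≤ suc n) (sym (↭-length (↭-shift (suc n) ys zs)))
      (s≤s (pigeonhole n rest! (All-InRange-shrink sn∉rest restInRange)))

  IsPerm : ℕ → List ℕ → Set
  IsPerm n w = length w ≡ n × All (InRange n) w × Unique w

  IsPerm-suc∉ : {n : ℕ} {π : List ℕ} → IsPerm n π → suc n ∉ π
  IsPerm-suc∉ (_ , inRange , _) sn∈π = ℕP.<-irrefl refl (proj₂ (All.lookup inRange sn∈π))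

  IsPerm-suc∈ : {n : ℕ} {w : List ℕ} → IsPerm (suc n) w → suc n ∈ w
  IsPerm-suc∈ {n} {w} (len , inRange , w!) with suc n ∈? w
  ... | yes sn∈w = sn∈w
  ... | no  sn∉w = contradiction (subst (_≤ n) len (pigeonhole n w! (All-InRange-shrink (∉⇒All≢ sn∉w) inRange)))
                                 (ℕP.<-irrefl refl)

  IsPerm-extend : {n : ℕ} {π w : List ℕ} → IsPerm n π → w ↭ suc n ∷ π → IsPerm (suc n) w
  IsPerm-extend {n} {π} isPerm@(len , inRange , π!) w↭ =
    trans (↭-length w↭) (cong suc len) ,
    All-resp-↭ (↭-sym w↭) ((s≤s z≤n , ℕP.≤-refl) ∷ All.map (λ (1≤x , x≤n) → 1≤x , ℕP.m≤n⇒m≤1+n x≤n) inRange) ,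
    Unique-resp-↭ (↭-sym w↭) (∉⇒All≢ (IsPerm-suc∉ isPerm) ∷ π!)

  IsPerm-shrink : {n : ℕ} {π w : List ℕ} → IsPerm (suc n) w → w ↭ suc n ∷ π → IsPerm n π
  IsPerm-shrink (len , inRange , w!) w↭
    with sn∉π ∷ π! ← Unique-resp-↭ w↭ w!
    with _ ∷ πInRange ← All-resp-↭ w↭ inRange =
    ℕP.suc-injective (trans (sym (↭-length w↭)) len) , All-InRange-shrink sn∉π πInRange , π!

  ∈-perms⁻ : (n : ℕ) {w : List ℕ} → w ∈ perms n → IsPerm n w
  ∈-perms⁻ n {w} w∈ with w∈words , distinct-w ← ∈-filter⁻ (λ w → distinct w Bool.≟ true) w∈
                    with len , letters ← ∈-words⁻ n (range n) w∈words =
    len , All.map (∈-range⁻ n) letters , distinct⇒Unique w distinct-w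

  ∈-perms⁺ : (n : ℕ) {w : List ℕ} → IsPerm n w → w ∈ perms n
  ∈-perms⁺ n {w} (refl , inRange , w!) =
    ∈-filter⁺ (λ w → distinct w Bool.≟ true) (∈-words⁺ (range n) (All.map (∈-range⁺ n) inRange)) (Unique⇒distinct w w!)

  perms-unique : (n : ℕ) → Unique (perms n)
  perms-unique n = Unique.filter⁺ (λ w → distinct w Bool.≟ true) (words-unique n (range-unique n))

  ∈-signedAlphabet⁻ : (k : ℕ) {x : ℤ} → x ∈ signedAlphabet k → InRange k ∣ x ∣
  ∈-signedAlphabet⁻ k x∈ with ∈-++⁻ (map +_ (range k)) x∈
  ... | inj₁ x∈⁺ with i , i∈ , refl ← ∈-map⁻ +_ x∈⁺ = ∈-range⁻ k i∈
  ... | inj₂ x∈⁻ with i , i∈ , refl ← ∈-map⁻ (λ i → - (+ i)) x∈⁻ =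
    subst (InRange k) (sym (ℤP.∣-i∣≡∣i∣ (+ i))) (∈-range⁻ k i∈)

  ∈-signedAlphabet⁺ : (k : ℕ) {x : ℤ} → InRange k ∣ x ∣ → x ∈ signedAlphabet k
  ∈-signedAlphabet⁺ k {+ i}      inRange = ∈-++⁺ˡ (∈-map⁺ +_ (∈-range⁺ k inRange))
  ∈-signedAlphabet⁺ k { -[1+ i ]} inRange = ∈-++⁺ʳ (map +_ (range k)) (∈-map⁺ (λ i → - (+ i)) (∈-range⁺ k inRange))

  signedAlphabet-unique : (k : ℕ) → Unique (signedAlphabet k)
  signedAlphabet-unique k =
    Unique.++⁺ (Unique.map⁺ ℤP.+-injective (range-unique k))
               (Unique.map⁺ (ℤP.+-injective ∘ ℤP.neg-injective) (range-unique k)) apart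
    where
    apart : Disjoint (map +_ (range k)) (map (λ i → - (+ i)) (range k))
    apart (x∈⁺ , x∈⁻) with i , _ , refl ← ∈-map⁻ +_ x∈⁺ with ∈-map⁻ (λ i → - (+ i)) x∈⁻
    ... | zero  , j∈ , _ = contradiction (proj₁ (∈-range⁻ k j∈)) λ ()
    ... | suc j , _  , ()

  ∈-signedPerms⁻ : (k : ℕ) {w : List ℤ} → w ∈ signedPerms k → IsPerm k (map ∣_∣ w)
  ∈-signedPerms⁻ k {w} w∈
    with w∈words , distinct-w ← ∈-filter⁻ (λ w → distinct (map ∣_∣ w) Bool.≟ true) w∈
    with len , letters ← ∈-words⁻ k (signedAlphabet k) w∈words =
    trans (length-map ∣_∣ w) len , AllP.map⁺ (All.map (∈-signedAlphabet⁻ k) letters) ,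
    distinct⇒Unique (map ∣_∣ w) distinct-w

  ∈-signedPerms⁺ : (k : ℕ) {w : List ℤ} → IsPerm k (map ∣_∣ w) → w ∈ signedPerms k
  ∈-signedPerms⁺ k {w} (len , inRange , w!) =
    ∈-filter⁺ (λ w → distinct (map ∣_∣ w) Bool.≟ true)
      (subst (λ l → w ∈ words l (signedAlphabet k)) (trans (sym (length-map ∣_∣ w)) len)
        (∈-words⁺ (signedAlphabet k) (All.map (∈-signedAlphabet⁺ k) (AllP.map⁻ inRange))))
      (Unique⇒distinct (map ∣_∣ w) w!)

  signedPerms-unique : (k : ℕ) → Unique (signedPerms k)
  signedPerms-unique k =
    Unique.filter⁺ (λ w → distinct (map ∣_∣ w) Bool.≟ true) (words-unique k (signedAlphabet-unique k))

  ∑-perms-suc : (n : ℕ) (g : List ℕ → ℤ) →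
    ∑ (perms (suc n)) g ≡ ∑[ π ∈ perms n ] ∑ (insertions (suc n) π) g
  ∑-perms-suc n g =
    ∑-fibres g (insertions (suc n)) (perms-unique n) (perms-unique (suc n))
      (λ π∈ → insertions-unique _ (IsPerm-suc∉ (∈-perms⁻ n π∈)))
      (λ π∈ π′∈ → insertions-injective ℕP._≟_ (IsPerm-suc∉ (∈-perms⁻ n π∈)) (IsPerm-suc∉ (∈-perms⁻ n π′∈)))
      covered
      (λ π∈ w∈ → ∈-perms⁺ (suc n) (IsPerm-extend (∈-perms⁻ n π∈) (∈-insertions⇒↭ _ w∈)))
    where
    covered : ∀ {w} → w ∈ perms (suc n) → ∃[ π ] π ∈ perms n × w ∈ insertions (suc n) π
    covered w∈ with isPerm ← ∈-perms⁻ (suc n) w∈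
               with ys , zs , refl ← ∈-∃++ (IsPerm-suc∈ isPerm) =
      ys ++ zs , ∈-perms⁺ n (IsPerm-shrink isPerm (↭-shift (suc n) ys zs)) , ∈-insertions ys zs

  ∑-signedPerms-suc : (k : ℕ) (g : List ℤ → ℤ) →
    ∑ (signedPerms (suc k)) g ≡ ∑[ σ ∈ signedPerms k ] (∑ (insertions (+ suc k) σ) g + ∑ (insertions -[1+ k ] σ) g)
  ∑-signedPerms-suc k g =
    trans (∑-fibres g signedInsertions (signedPerms-unique k) (signedPerms-unique (suc k))
             fibre-unique disjoint covered inside)
          (∑-cong (signedPerms k) (λ {σ} _ → ∑-++ (insertions (+ suc k) σ) (insertions -[1+ k ] σ) g))
    where
    signedInsertions : List ℤ → List (List ℤ)
    signedInsertions σ = insertions (+ suc k) σ ++ insertions -[1+ k ] σ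

    extreme∉ : ∀ {a σ} → σ ∈ signedPerms k → ∣ a ∣ ≡ suc k → a ∉ σ
    extreme∉ {σ = σ} σ∈ ∣a∣≡ a∈σ = IsPerm-suc∉ (∈-signedPerms⁻ k σ∈) (subst (_∈ map ∣_∣ σ) ∣a∣≡ (∈-map⁺ ∣_∣ a∈σ))

    inserted-once : ∀ {σ σ′ w} → σ ∈ signedPerms k → w ∈ insertions (+ suc k) σ → w ∈ insertions -[1+ k ] σ′ → ⊥
    inserted-once σ∈ w∈⁺ w∈⁻
      with ∈-resp-↭ (∈-insertions⇒↭ _ w∈⁺) (∈-resp-↭ (↭-sym (∈-insertions⇒↭ _ w∈⁻)) (here refl))
    ... | there m∈σ = extreme∉ σ∈ refl m∈σ

    fibre-unique : ∀ {σ} → σ ∈ signedPerms k → Unique (signedInsertions σ)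
    fibre-unique σ∈ = Unique.++⁺ (insertions-unique _ (extreme∉ σ∈ refl)) (insertions-unique _ (extreme∉ σ∈ refl))
                                 (λ (w∈⁺ , w∈⁻) → inserted-once σ∈ w∈⁺ w∈⁻)

    disjoint : ∀ {σ σ′ w} → σ ∈ signedPerms k → σ′ ∈ signedPerms k →
      w ∈ signedInsertions σ → w ∈ signedInsertions σ′ → σ ≡ σ′
    disjoint {σ} {σ′} σ∈ σ′∈ w∈ w∈′ with ∈-++⁻ (insertions (+ suc k) σ) w∈ | ∈-++⁻ (insertions (+ suc k) σ′) w∈′
    ... | inj₁ p | inj₁ q = insertions-injective ℤ._≟_ (extreme∉ σ∈ refl) (extreme∉ σ′∈ refl) p q
    ... | inj₂ p | inj₂ q = insertions-injective ℤ._≟_ (extreme∉ σ∈ refl) (extreme∉ σ′∈ refl) p q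
    ... | inj₁ p | inj₂ q = ⊥-elim (inserted-once σ∈ p q)
    ... | inj₂ p | inj₁ q = ⊥-elim (inserted-once σ′∈ q p)

    insertion-of : (x : ℤ) → suc k ≡ ∣ x ∣ → (ys zs : List ℤ) → ys ++ x ∷ zs ∈ signedInsertions (ys ++ zs)
    insertion-of (+ _)      refl ys zs = ∈-++⁺ˡ (∈-insertions ys zs)
    insertion-of -[1+ _ ] refl ys zs = ∈-++⁺ʳ (insertions (+ suc k) (ys ++ zs)) (∈-insertions ys zs)

    covered : ∀ {w} → w ∈ signedPerms (suc k) → ∃[ σ ] σ ∈ signedPerms k × w ∈ signedInsertions σ
    covered w∈ with isPerm ← ∈-signedPerms⁻ (suc k) w∈
               with x , x∈w , sk≡∣x∣ ← ∈-map⁻ ∣_∣ (IsPerm-suc∈ isPerm)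
               with ys , zs , refl ← ∈-∃++ x∈w =
      ys ++ zs ,
      ∈-signedPerms⁺ k (IsPerm-shrink isPerm (subst (λ a → map ∣_∣ (ys ++ x ∷ zs) ↭ a ∷ map ∣_∣ (ys ++ zs))
                                                   (sym sk≡∣x∣) (map⁺ ∣_∣ (↭-shift x ys zs)))) ,
      insertion-of x sk≡∣x∣ ys zs

    inside : ∀ {σ w} → σ ∈ signedPerms k → w ∈ signedInsertions σ → w ∈ signedPerms (suc k)
    inside {σ} σ∈ w∈ with ∈-++⁻ (insertions (+ suc k) σ) w∈
    ... | inj₁ w∈⁺ = ∈-signedPerms⁺ (suc k) (IsPerm-extend (∈-signedPerms⁻ k σ∈) (map⁺ ∣_∣ (∈-insertions⇒↭ σ w∈⁺)))
    ... | inj₂ w∈⁻ = ∈-signedPerms⁺ (suc k) (IsPerm-extend (∈-signedPerms⁻ k σ∈) (map⁺ ∣_∣ (∈-insertions⇒↭ σ w∈⁻)))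

  -- Worpitzky identities

  isYes-true : {P : Set} (p? : Dec P) → P → ⌊ p? ⌋ ≡ true
  isYes-true p? p = trans (isYes≗does p?) (dec-true p? p)

  isYes-false : {P : Set} (p? : Dec P) → ¬ P → ⌊ p? ⌋ ≡ false
  isYes-false p? ¬p = trans (isYes≗does p?) (dec-false p? ¬p)

  isDescentℕ : ℕ → ℕ → Bool
  isDescentℕ x y = ⌊ y ℕ.<? x ⌋

  isDescentℤ : ℤ → ℤ → Bool
  isDescentℤ x y = ⌊ y ℤ.<? x ⌋

  des≡desBy : (w : List ℕ) → des w ≡ desBy isDescentℕ w
  des≡desBy []           = refl
  des≡desBy (x ∷ [])     = refl
  des≡desBy (x ∷ y ∷ w) = cong ((if isDescentℕ x y then 1 else 0) ℕ.+_) (des≡desBy (y ∷ w))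

  desℤ≡desBy : (w : List ℤ) → desℤ w ≡ desBy isDescentℤ w
  desℤ≡desBy []           = refl
  desℤ≡desBy (x ∷ [])     = refl
  desℤ≡desBy (x ∷ y ∷ w) = cong ((if isDescentℤ x y then 1 else 0) ℕ.+_) (desℤ≡desBy (y ∷ w))

  des-≤ : (n : ℕ) {π : List ℕ} → π ∈ perms n → des π ≤ n
  des-≤ n {π} π∈ = subst₂ _≤_ (sym (des≡desBy π)) (proj₁ (∈-perms⁻ n π∈)) (desBy-≤ isDescentℕ π)

  desB-≤ : (k : ℕ) {σ : List ℤ} → σ ∈ signedPerms k → desB σ ≤ k
  desB-≤ k {σ} σ∈ = subst₂ _≤_ (sym (desℤ≡desBy (+ 0 ∷ σ))) (trans (sym (length-map ∣_∣ σ)) (proj₁ (∈-signedPerms⁻ k σ∈)))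
                            (desBy-∷-≤ isDescentℤ (+ 0) σ)

  above-perm : {n : ℕ} {π : List ℕ} → All (InRange n) π → All (Above isDescentℕ (suc n)) π
  above-perm = All.map λ (_ , x≤n) → isYes-true (_ ℕ.<? _) (s≤s x≤n) , isYes-false (_ ℕ.<? _) (ℕP.<⇒≱ (s≤s x≤n) ∘ ℕP.<⇒≤)

  above-signedPerm : {k : ℕ} {σ : List ℤ} → All (InRange k ∘ ∣_∣) σ → All (Above isDescentℤ (+ suc k)) (+ 0 ∷ σ)
  above-signedPerm {k} inRange = above {+ 0} z≤n ∷ All.map (above ∘ proj₂) inRange
    where
    below-top : ∀ {z} → ∣ z ∣ ≤ k → z ℤ.< + suc k
    below-top {+ _}      z≤k = ℤ.+<+ (s≤s z≤k)
    below-top { -[1+ _ ]} _  = ℤ.-<+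
    above : ∀ {z} → ∣ z ∣ ≤ k → Above isDescentℤ (+ suc k) z
    above {z} z≤k =
      isYes-true (z ℤ.<? + suc k) (below-top z≤k) , isYes-false (+ suc k ℤ.<? z) (ℤP.<-asym (below-top z≤k))

  below-signedPerm : {k : ℕ} {σ : List ℤ} → All (InRange k ∘ ∣_∣) σ → All (Below isDescentℤ -[1+ k ]) (+ 0 ∷ σ)
  below-signedPerm {k} inRange = below {+ 0} z≤n ∷ All.map (below ∘ proj₂) inRange
    where
    above-bottom : ∀ {z} → ∣ z ∣ ≤ k → -[1+ k ] ℤ.< z
    above-bottom {+ _}      _   = ℤ.-<+
    above-bottom { -[1+ _ ]} z≤k = ℤ.-<- z≤k
    below : ∀ {z} → ∣ z ∣ ≤ k → Below isDescentℤ -[1+ k ] z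
    below {z} z≤k =
      isYes-true (-[1+ k ] ℤ.<? z) (above-bottom z≤k) , isYes-false (z ℤ.<? -[1+ k ]) (ℤP.<-asym (above-bottom z≤k))

  eulerian : ℕ → Seq
  eulerian n i = ∑[ π ∈ perms n ] δ (des π) i

  eulerianB : ℕ → Seq
  eulerianB k i = ∑[ σ ∈ signedPerms k ] δ (desB σ) i

  A≡horner : (n : ℕ) (t : ℤ) → A n t ≡ horner n (eulerian n) t
  A≡horner n t = trans (∑-cong (perms n) (λ {π} π∈ → sym (horner-δ n (des π) t (des-≤ n π∈))))
                       (sym (horner-∑ n (perms n) (δ ∘ des) t))

  B≡horner : (k : ℕ) (t : ℤ) → B k t ≡ horner k (eulerianB k) t
  B≡horner k t = trans (∑-cong (signedPerms k) (λ {σ} σ∈ → sym (horner-δ k (desB σ) t (desB-≤ k σ∈))))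
                       (sym (horner-∑ k (signedPerms k) (δ ∘ desB) t))

  eulerianB-vanishesAbove : (k : ℕ) → VanishesAbove k (eulerianB k)
  eulerianB-vanishesAbove k k<i =
    trans (∑-cong (signedPerms k) (λ σ∈ → δ-vanishesAbove (desB-≤ k σ∈) k<i)) (∑-zero (signedPerms k))

  partialSums^-eulerian : (D n m : ℕ) →
    partialSums^ (suc D) (eulerian n) m ≡ ∑[ π ∈ perms n ] + negBinomFrom D (des π) m
  partialSums^-eulerian D n m =
    trans (partialSums^-∑ (suc D) (perms n) (δ ∘ des) m) (∑-cong (perms n) (λ {π} _ → partialSums^-δ D (des π) m))

  partialSums^-eulerianB : (D k m : ℕ) →
    partialSums^ (suc D) (eulerianB k) m ≡ ∑[ σ ∈ signedPerms k ] + negBinomFrom D (desB σ) m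
  partialSums^-eulerianB D k m =
    trans (partialSums^-∑ (suc D) (signedPerms k) (δ ∘ desB) m)
          (∑-cong (signedPerms k) (λ {σ} _ → partialSums^-δ D (desB σ) m))

  pos-*-+-* : (a b c e : ℕ) → + (a ℕ.* b ℕ.+ c ℕ.* e) ≡ + a * + b + + c * + e
  pos-*-+-* a b c e = trans (ℤP.pos-+ (a ℕ.* b) (c ℕ.* e)) (cong₂ _+_ (ℤP.pos-* a b) (ℤP.pos-* c e))

  ∑-insertions-negBinomFrom : (n m : ℕ) {π : List ℕ} → π ∈ perms n →
    ∑[ w ∈ insertions (suc n) π ] + negBinomFrom (suc n) (des w) m ≡ + suc m * + negBinomFrom n (des π) m
  ∑-insertions-negBinomFrom n m {π} π∈ = begin
    ∑[ w ∈ insertions (suc n) π ] + negBinomFrom (suc n) (des w) m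
      ≡⟨ ∑-cong (insertions (suc n) π) (λ {w} _ → cong h (des≡desBy w)) ⟩
    ∑[ w ∈ insertions (suc n) π ] h (desBy isDescentℕ w)
      ≡⟨ ∑-insertions-max isDescentℕ h π (above-perm inRange) ⟩
    + suc d * h d + + (length π ∸ d) * h (suc d)
      ≡⟨ cong (λ l → + suc d * h d + + (l ∸ d) * h (suc d)) len ⟩
    + suc d * h d + + (n ∸ d) * h (suc d)
      ≡⟨ pos-*-+-* (suc d) (negBinomFrom (suc n) d m) (n ∸ d) (negBinomFrom (suc n) (suc d) m) ⟨
    + (suc d ℕ.* negBinomFrom (suc n) d m ℕ.+ (n ∸ d) ℕ.* negBinomFrom (suc n) (suc d) m)
      ≡⟨ cong +_ (negBinomFrom-insertMax n d m (subst (d ≤_) len (desBy-≤ isDescentℕ π))) ⟩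
    + (suc m ℕ.* negBinomFrom n d m)
      ≡⟨ ℤP.pos-* (suc m) _ ⟩
    + suc m * + negBinomFrom n d m
      ≡⟨ cong (λ e → + suc m * + negBinomFrom n e m) (des≡desBy π) ⟨
    + suc m * + negBinomFrom n (des π) m ∎
    where
    open ≡-Reasoning
    h : ℕ → ℤ
    h e = + negBinomFrom (suc n) e m
    d = desBy isDescentℕ π
    len = proj₁ (∈-perms⁻ n π∈)
    inRange = proj₁ (proj₂ (∈-perms⁻ n π∈))

  ∑-insertions±-negBinomFrom : (k m : ℕ) {σ : List ℤ} → σ ∈ signedPerms k →
    (∑[ w ∈ insertions (+ suc k) σ ] + negBinomFrom (suc k) (desB w) m)
      + (∑[ w ∈ insertions -[1+ k ] σ ] + negBinomFrom (suc k) (desB w) m)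
      ≡ + suc (m ℕ.+ m) * + negBinomFrom k (desB σ) m
  ∑-insertions±-negBinomFrom k m {σ} σ∈ = begin
    (∑[ w ∈ insertions (+ suc k) σ ] + negBinomFrom (suc k) (desB w) m)
      + (∑[ w ∈ insertions -[1+ k ] σ ] + negBinomFrom (suc k) (desB w) m)
      ≡⟨ cong₂ _+_ (∑-cong (insertions (+ suc k) σ) (λ {w} _ → cong h (desℤ≡desBy (+ 0 ∷ w))))
                   (∑-cong (insertions -[1+ k ] σ) (λ {w} _ → cong h (desℤ≡desBy (+ 0 ∷ w)))) ⟩
    (∑[ w ∈ insertions (+ suc k) σ ] h (desBy isDescentℤ (+ 0 ∷ w)))
      + (∑[ w ∈ insertions -[1+ k ] σ ] h (desBy isDescentℤ (+ 0 ∷ w)))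
      ≡⟨ cong₂ _+_ (∑-insertions-max-behind isDescentℤ h (+ 0) σ (above-signedPerm inRange))
                   (∑-insertions-min-behind isDescentℤ h (+ 0) σ (below-signedPerm inRange)) ⟩
    (+ suc e * h e + + (length σ ∸ e) * h (suc e)) + (+ e * h e + + (suc (length σ) ∸ e) * h (suc e))
      ≡⟨ cong (λ l → (+ suc e * h e + + (l ∸ e) * h (suc e)) + (+ e * h e + + (suc l ∸ e) * h (suc e))) len ⟩
    (+ suc e * h e + + (k ∸ e) * h (suc e)) + (+ e * h e + + (suc k ∸ e) * h (suc e))
      ≡⟨ cong₂ _+_ (pos-*-+-* (suc e) X (k ∸ e) Y) (pos-*-+-* e X (suc k ∸ e) Y) ⟨
    + (suc e ℕ.* X ℕ.+ (k ∸ e) ℕ.* Y) + + (e ℕ.* X ℕ.+ (suc k ∸ e) ℕ.* Y)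
      ≡⟨ ℤP.pos-+ (suc e ℕ.* X ℕ.+ (k ∸ e) ℕ.* Y) (e ℕ.* X ℕ.+ (suc k ∸ e) ℕ.* Y) ⟨
    + (suc e ℕ.* X ℕ.+ (k ∸ e) ℕ.* Y ℕ.+ (e ℕ.* X ℕ.+ (suc k ∸ e) ℕ.* Y))
      ≡⟨ cong +_ (negBinomFrom-insertMaxMin k e m (subst (e ≤_) len (desBy-∷-≤ isDescentℤ (+ 0) σ))) ⟩
    + (suc (m ℕ.+ m) ℕ.* negBinomFrom k e m)
      ≡⟨ ℤP.pos-* (suc (m ℕ.+ m)) _ ⟩
    + suc (m ℕ.+ m) * + negBinomFrom k e m
      ≡⟨ cong (λ e → + suc (m ℕ.+ m) * + negBinomFrom k e m) (desℤ≡desBy (+ 0 ∷ σ)) ⟨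
    + suc (m ℕ.+ m) * + negBinomFrom k (desB σ) m ∎
    where
    open ≡-Reasoning
    h : ℕ → ℤ
    h e = + negBinomFrom (suc k) e m
    e = desBy isDescentℤ (+ 0 ∷ σ)
    X = negBinomFrom (suc k) e m
    Y = negBinomFrom (suc k) (suc e) m
    len : length σ ≡ k
    len = trans (sym (length-map ∣_∣ σ)) (proj₁ (∈-signedPerms⁻ k σ∈))
    inRange : All (InRange k ∘ ∣_∣) σ
    inRange = AllP.map⁻ (proj₁ (proj₂ (∈-signedPerms⁻ k σ∈)))

  worpitzkyA : (n m : ℕ) → partialSums^ (suc n) (eulerian n) m ≡ (+ suc m) ^ n
  worpitzkyA zero    m = partialSums^-eulerian 0 0 m
  worpitzkyA (suc n) m = begin
    partialSums^ (suc (suc n)) (eulerian (suc n)) m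
      ≡⟨ partialSums^-eulerian (suc n) (suc n) m ⟩
    ∑[ w ∈ perms (suc n) ] + negBinomFrom (suc n) (des w) m
      ≡⟨ ∑-perms-suc n (λ w → + negBinomFrom (suc n) (des w) m) ⟩
    ∑[ π ∈ perms n ] ∑[ w ∈ insertions (suc n) π ] + negBinomFrom (suc n) (des w) m
      ≡⟨ ∑-cong (perms n) (∑-insertions-negBinomFrom n m) ⟩
    ∑[ π ∈ perms n ] + suc m * + negBinomFrom n (des π) m
      ≡⟨ ∑-*ˡ (+ suc m) (perms n) (λ π → + negBinomFrom n (des π) m) ⟩
    + suc m * (∑[ π ∈ perms n ] + negBinomFrom n (des π) m)
      ≡⟨ cong (+ suc m *_) (partialSums^-eulerian n n m) ⟨
    + suc m * partialSums^ (suc n) (eulerian n) m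
      ≡⟨ cong (+ suc m *_) (worpitzkyA n m) ⟩
    + suc m * (+ suc m) ^ n ∎
    where open ≡-Reasoning

  worpitzkyB : (k m : ℕ) → partialSums^ (suc k) (eulerianB k) m ≡ (+ suc (m ℕ.+ m)) ^ k
  worpitzkyB zero    m = partialSums^-eulerianB 0 0 m
  worpitzkyB (suc k) m = begin
    partialSums^ (suc (suc k)) (eulerianB (suc k)) m
      ≡⟨ partialSums^-eulerianB (suc k) (suc k) m ⟩
    ∑[ w ∈ signedPerms (suc k) ] g w
      ≡⟨ ∑-signedPerms-suc k g ⟩
    ∑[ σ ∈ signedPerms k ] (∑ (insertions (+ suc k) σ) g + ∑ (insertions -[1+ k ] σ) g)
      ≡⟨ ∑-cong (signedPerms k) (∑-insertions±-negBinomFrom k m) ⟩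
    ∑[ σ ∈ signedPerms k ] + suc (m ℕ.+ m) * + negBinomFrom k (desB σ) m
      ≡⟨ ∑-*ˡ (+ suc (m ℕ.+ m)) (signedPerms k) (λ σ → + negBinomFrom k (desB σ) m) ⟩
    + suc (m ℕ.+ m) * (∑[ σ ∈ signedPerms k ] + negBinomFrom k (desB σ) m)
      ≡⟨ cong (+ suc (m ℕ.+ m) *_) (partialSums^-eulerianB k k m) ⟨
    + suc (m ℕ.+ m) * partialSums^ (suc k) (eulerianB k) m
      ≡⟨ cong (+ suc (m ℕ.+ m) *_) (worpitzkyB k m) ⟩
    + suc (m ℕ.+ m) * (+ suc (m ℕ.+ m)) ^ k ∎
    where
    open ≡-Reasoning
    g : List ℤ → ℤ
    g w = + negBinomFrom (suc k) (desB w) m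

  -- The odd part of the binomial theorem

  binomial-theorem : (n : ℕ) (x y : ℤ) → (x + y) ^ n ≡ ∑[ k < suc n ] + (n C k) * (x ^ k * y ^ (n ∸ k))
  binomial-theorem n x y = begin
    (x + y) ^ n                             ≡⟨ ^≡^ (x + y) n ⟨
    (x + y) ^ₛ n                    ≡⟨ Binomial.theorem n x y ⟩
    Binomial.binomialExpansion x y n        ≡⟨ foldr≡∑< (suc n) (λ k → (n C k) ×ₛ (x ^ₛ k * y ^ₛ (n ∸ k))) ⟩
    ∑[ k < suc n ] (n C k) ×ₛ (x ^ₛ k * y ^ₛ (n ∸ k))
      ≡⟨ ∑<-cong (suc n) (λ {k} _ → trans (×≡* (n C k) _)
                                         (cong₂ (λ a b → + (n C k) * (a * b)) (^≡^ x k) (^≡^ y (n ∸ k)))) ⟩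
    ∑[ k < suc n ] + (n C k) * (x ^ k * y ^ (n ∸ k)) ∎
    where
    open ≡-Reasoning
    ^≡^ : (x : ℤ) (n : ℕ) → x ^ₛ n ≡ x ^ n
    ^≡^ x zero    = refl
    ^≡^ x (suc n) = cong (x *_) (^≡^ x n)
    ×≡* : (n : ℕ) (x : ℤ) → n ×ₛ x ≡ + n * x
    ×≡* zero    x = sym (ℤP.*-zeroˡ x)
    ×≡* (suc n) x = trans (cong (_+_ x) (×≡* n x)) (sym (ℤP.suc-* (+ n) x))
    foldr≡∑< : (n : ℕ) (f : ℕ → ℤ) → Vector.foldr _+_ (+ 0) {n} (f ∘ toℕ) ≡ ∑< n f
    foldr≡∑< zero    f = refl
    foldr≡∑< (suc n) f = cong (_+_ (f 0)) (foldr≡∑< n (f ∘ suc))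

  double : ℕ → ℕ
  double zero    = zero
  double (suc n) = suc (suc (double n))

  data Parity : ℕ → Set where
    even : (p : ℕ) → Parity (double p)
    odd  : (p : ℕ) → Parity (suc (double p))

  parity : (n : ℕ) → Parity n
  parity zero    = even zero
  parity (suc n) with parity n
  ... | even p = odd p
  ... | odd  p = even (suc p)

  double≡*2 : (n : ℕ) → double n ≡ n ℕ.* 2
  double≡*2 zero    = refl
  double≡*2 (suc n) = cong (suc ∘ suc) (double≡*2 n)

  2*≡double : (n : ℕ) → 2 ℕ.* n ≡ double n
  2*≡double n = trans (ℕP.*-comm 2 n) (sym (double≡*2 n))

  2*+1≡suc-double : (n : ℕ) → 2 ℕ.* n ℕ.+ 1 ≡ suc (double n)
  2*+1≡suc-double n = trans (ℕP.+-comm (2 ℕ.* n) 1) (cong suc (2*≡double n))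

  double-%2 : (p : ℕ) → double p % 2 ≡ 0
  double-%2 p = trans (cong (_% 2) (double≡*2 p)) (m*n%n≡0 p 2)

  suc-double-%2 : (p : ℕ) → suc (double p) % 2 ≡ 1
  suc-double-%2 p = trans (cong (λ m → suc m % 2) (double≡*2 p)) ([m+kn]%n≡m%n 1 p 2)

  double-/2 : (p : ℕ) → double p / 2 ℕ.+ 1 ≡ suc p
  double-/2 p = trans (cong (λ m → m / 2 ℕ.+ 1) (double≡*2 p)) (trans (cong (ℕ._+ 1) (m*n/n≡m p 2)) (ℕP.+-comm p 1))

  double-+ : (m n : ℕ) → double m ℕ.+ double n ≡ double (m ℕ.+ n)
  double-+ zero    n = refl
  double-+ (suc m) n = cong (suc ∘ suc) (double-+ m n)

  double-split : {p r : ℕ} → r ≤ p → double r ℕ.+ double (p ∸ r) ≡ double p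
  double-split {p} {r} r≤p = trans (double-+ r (p ∸ r)) (cong double (ℕP.m+[n∸m]≡n r≤p))

  double-∸ : (m n : ℕ) → double m ∸ double n ≡ double (m ∸ n)
  double-∸ m       zero    = refl
  double-∸ zero    (suc n) = refl
  double-∸ (suc m) (suc n) = double-∸ m n

  suc-double-∸ : (m n : ℕ) → n ≤ m → suc (double m) ∸ double n ≡ suc (double (m ∸ n))
  suc-double-∸ m       zero    _         = refl
  suc-double-∸ (suc m) (suc n) (s≤s n≤m) = suc-double-∸ m n n≤m

  ∑<-double : (a : ℕ) (g : ℕ → ℤ) → ∑< (double a) g ≡ (∑[ r < a ] g (double r)) + (∑[ r < a ] g (suc (double r)))
  ∑<-double zero    g = refl
  ∑<-double (suc a) g =
    trans (cong (λ s → g 0 + (g 1 + s)) (∑<-double a (g ∘ suc ∘ suc)))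
          (interleave (g 0) (g 1) (∑[ r < a ] g (suc (suc (double r)))) (∑[ r < a ] g (suc (suc (suc (double r))))))
    where
    interleave : ∀ a b c d → a + (b + (c + d)) ≡ (a + c) + (b + d)
    interleave = solve-∀

  ∑<-suc-double : (a : ℕ) (g : ℕ → ℤ) →
    ∑< (suc (double a)) g ≡ (∑[ r < suc a ] g (double r)) + (∑[ r < a ] g (suc (double r)))
  ∑<-suc-double a g =
    trans (cong (_+_ (g 0)) (∑<-double a (g ∘ suc)))
          (rotate (g 0) (∑[ r < a ] g (suc (double r))) (∑[ r < a ] g (suc (suc (double r)))))
    where
    rotate : ∀ a b c → a + (b + c) ≡ (a + c) + b
    rotate = solve-∀

  -1^double : (b : ℕ) → -[1+ 0 ] ^ double b ≡ + 1
  -1^double zero    = refl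
  -1^double (suc b) = cong (λ y → -[1+ 0 ] * (-[1+ 0 ] * y)) (-1^double b)

  sign-difference : ℕ → ℤ
  sign-difference j = (+ 1) ^ j - -[1+ 0 ] ^ j

  *-sign-difference-double : (c : ℤ) {j b : ℕ} → j ≡ double b → c * sign-difference j ≡ + 0
  *-sign-difference-double c {b = b} refl =
    trans (cong (c *_) (cong₂ _-_ (ℤP.^-zeroˡ (double b)) (-1^double b))) (ℤP.*-zeroʳ c)

  *-sign-difference-suc-double : (c : ℤ) {j b : ℕ} → j ≡ suc (double b) → c * sign-difference j ≡ + 2 * c
  *-sign-difference-suc-double c {b = b} refl =
    trans (cong (c *_) (cong₂ _-_ (ℤP.^-zeroˡ (suc (double b))) (cong (-[1+ 0 ] *_) (-1^double b)))) (ℤP.*-comm c (+ 2))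

  binomial-difference : (n : ℕ) (x : ℤ) →
    (x + + 1) ^ n - (x - + 1) ^ n ≡ ∑[ k < suc n ] + (n C k) * x ^ k * sign-difference (n ∸ k)
  binomial-difference n x = begin
    (x + + 1) ^ n - (x - + 1) ^ n
      ≡⟨ cong₂ _-_ (binomial-theorem n x (+ 1)) (binomial-theorem n x -[1+ 0 ]) ⟩
    (∑[ k < suc n ] + (n C k) * (x ^ k * (+ 1) ^ (n ∸ k))) - (∑[ k < suc n ] + (n C k) * (x ^ k * -[1+ 0 ] ^ (n ∸ k)))
      ≡⟨ ∑<-diff (suc n) (λ k → + (n C k) * (x ^ k * (+ 1) ^ (n ∸ k))) (λ k → + (n C k) * (x ^ k * -[1+ 0 ] ^ (n ∸ k))) ⟩
    ∑[ k < suc n ] (+ (n C k) * (x ^ k * (+ 1) ^ (n ∸ k)) - + (n C k) * (x ^ k * -[1+ 0 ] ^ (n ∸ k)))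
      ≡⟨ ∑<-cong (suc n) (λ {k} _ → factor (+ (n C k)) (x ^ k) ((+ 1) ^ (n ∸ k)) (-[1+ 0 ] ^ (n ∸ k))) ⟩
    ∑[ k < suc n ] + (n C k) * x ^ k * sign-difference (n ∸ k) ∎
    where
    open ≡-Reasoning
    factor : ∀ c y a b → c * (y * a) - c * (y * b) ≡ c * y * (a - b)
    factor = solve-∀

  binomial-difference-even : (p : ℕ) (x : ℤ) → let n = double (suc p) in
    + 2 * (∑[ r ∈ upTo (suc p) ] + (n C (2 ℕ.* r ℕ.+ 1)) * x ^ (2 ℕ.* r ℕ.+ 1)) ≡ (x + + 1) ^ n - (x - + 1) ^ n
  binomial-difference-even p x = begin
    + 2 * (∑[ r ∈ upTo (suc p) ] term (2 ℕ.* r ℕ.+ 1))             ≡⟨ cong (+ 2 *_) reindex ⟩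
    + 2 * (∑[ r < suc p ] term (suc (double r)))                   ≡⟨ ∑<-*ˡ (suc p) (+ 2) (term ∘ suc ∘ double) ⟨
    ∑[ r < suc p ] + 2 * term (suc (double r))                     ≡⟨ ∑<-cong (suc p) odd-terms ⟨
    ∑[ r < suc p ] D (suc (double r))                              ≡⟨ ℤP.+-identityˡ _ ⟨
    + 0 + (∑[ r < suc p ] D (suc (double r)))                      ≡⟨ cong (_+ (∑[ r < suc p ] D (suc (double r)))) even-terms ⟨
    (∑[ r < suc (suc p) ] D (double r)) + (∑[ r < suc p ] D (suc (double r))) ≡⟨ ∑<-suc-double (suc p) D ⟨
    ∑[ k < suc n ] D k                                             ≡⟨ binomial-difference n x ⟨
    (x + + 1) ^ n - (x - + 1) ^ n                                  ∎
    where
    open ≡-Reasoning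
    n = double (suc p)
    term : ℕ → ℤ
    term k = + (n C k) * x ^ k
    D : ℕ → ℤ
    D k = term k * sign-difference (n ∸ k)
    reindex : ∑[ r ∈ upTo (suc p) ] term (2 ℕ.* r ℕ.+ 1) ≡ ∑[ r < suc p ] term (suc (double r))
    reindex = trans (∑-upTo (suc p) (λ r → term (2 ℕ.* r ℕ.+ 1)))
                    (∑<-cong (suc p) (λ {r} _ → cong term (2*+1≡suc-double r)))
    odd-terms : ∀ {r} → r < suc p → D (suc (double r)) ≡ + 2 * term (suc (double r))
    odd-terms {r} r<sp = *-sign-difference-suc-double (term (suc (double r))) (suc-double-∸ p r (ℕP.≤-pred r<sp))
    even-terms : ∑[ r < suc (suc p) ] D (double r) ≡ + 0
    even-terms = trans (∑<-cong (suc (suc p)) (λ {r} _ → *-sign-difference-double (term (double r)) (double-∸ (suc p) r)))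
                       (∑<-zero (suc (suc p)))

  binomial-difference-odd : (p : ℕ) (x : ℤ) → let n = suc (double p) in
    + 2 * (∑[ r ∈ upTo (suc p) ] + (n C (2 ℕ.* r)) * x ^ (2 ℕ.* r)) ≡ (x + + 1) ^ n - (x - + 1) ^ n
  binomial-difference-odd p x = begin
    + 2 * (∑[ r ∈ upTo (suc p) ] term (2 ℕ.* r))                   ≡⟨ cong (+ 2 *_) reindex ⟩
    + 2 * (∑[ r < suc p ] term (double r))                         ≡⟨ ∑<-*ˡ (suc p) (+ 2) (term ∘ double) ⟨
    ∑[ r < suc p ] + 2 * term (double r)                           ≡⟨ ∑<-cong (suc p) even-terms ⟨
    ∑[ r < suc p ] D (double r)                                    ≡⟨ ℤP.+-identityʳ _ ⟨
    (∑[ r < suc p ] D (double r)) + + 0                            ≡⟨ cong (_+_ (∑[ r < suc p ] D (double r))) odd-terms ⟨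
    (∑[ r < suc p ] D (double r)) + (∑[ r < suc p ] D (suc (double r))) ≡⟨ ∑<-double (suc p) D ⟨
    ∑[ k < suc n ] D k                                             ≡⟨ binomial-difference n x ⟨
    (x + + 1) ^ n - (x - + 1) ^ n                                  ∎
    where
    open ≡-Reasoning
    n = suc (double p)
    term : ℕ → ℤ
    term k = + (n C k) * x ^ k
    D : ℕ → ℤ
    D k = term k * sign-difference (n ∸ k)
    reindex : ∑[ r ∈ upTo (suc p) ] term (2 ℕ.* r) ≡ ∑[ r < suc p ] term (double r)
    reindex = trans (∑-upTo (suc p) (λ r → term (2 ℕ.* r))) (∑<-cong (suc p) (λ {r} _ → cong term (2*≡double r)))
    even-terms : ∀ {r} → r < suc p → D (double r) ≡ + 2 * term (double r)
    even-terms {r} r<sp = *-sign-difference-suc-double (term (double r)) (suc-double-∸ p r (ℕP.≤-pred r<sp))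
    odd-terms : ∑[ r < suc p ] D (suc (double r)) ≡ + 0
    odd-terms = trans (∑<-cong (suc p) (λ {r} _ → *-sign-difference-double (term (suc (double r))) (double-∸ p r)))
                      (∑<-zero (suc p))

  -- Aₙ in terms of the B_k

  ^-double : (x : ℤ) (a : ℕ) → x ^ double a ≡ (x * x) ^ a
  ^-double x zero    = refl
  ^-double x (suc a) = trans (sym (ℤP.*-assoc x x (x ^ double a))) (cong (x * x *_) (^-double x a))

  pos-^ : (a n : ℕ) → + (a ℕ.^ n) ≡ (+ a) ^ n
  pos-^ a zero    = refl
  pos-^ a (suc n) = trans (ℤP.pos-* a (a ℕ.^ n)) (cong (+ a *_) (pos-^ a n))

  ^-distribʳ-* : (x y : ℤ) (n : ℕ) → (x * y) ^ n ≡ x ^ n * y ^ n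
  ^-distribʳ-* x y zero    = refl
  ^-distribʳ-* x y (suc n) = trans (cong (x * y *_) (^-distribʳ-* x y n)) (interchange x y (x ^ n) (y ^ n))
    where
    interchange : ∀ a b c d → a * b * (c * d) ≡ a * c * (b * d)
    interchange = solve-∀

  B-term≡horner : (n′ k a c : ℕ) (t : ℤ) → k ℕ.+ double a ≡ n′ →
    + c * B k t * (t - + 1) ^ double a ≡ horner (suc n′) (λ i → + c * Δ^ (double a) (eulerianB k) i) t
  B-term≡horner n′ k a c t k+2a≡n′ = begin
    + c * B k t * (t - + 1) ^ double a
      ≡⟨ cong₂ (λ b s → + c * b * s) (B≡horner k t) (even-power (t - + 1) (+ 1 - t) (flip t)) ⟩
    + c * horner k (eulerianB k) t * (+ 1 - t) ^ double a
      ≡⟨ reorder (+ c) (horner k (eulerianB k) t) ((+ 1 - t) ^ double a) ⟩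
    + c * ((+ 1 - t) ^ double a * horner k (eulerianB k) t)
      ≡⟨ cong (+ c *_) (horner-Δ^ k (double a) (eulerianB k) t (eulerianB-vanishesAbove k)) ⟨
    + c * horner (double a ℕ.+ k) (Δ^ (double a) (eulerianB k)) t
      ≡⟨ cong (+ c *_) (horner-extend (double a ℕ.+ k) (Δ^ (double a) (eulerianB k)) t
                          (Δ^-vanishesAbove k (double a) (eulerianB k) (eulerianB-vanishesAbove k))) ⟨
    + c * horner (suc (double a ℕ.+ k)) (Δ^ (double a) (eulerianB k)) t
      ≡⟨ cong (λ D → + c * horner (suc D) (Δ^ (double a) (eulerianB k)) t) (trans (ℕP.+-comm (double a) k) k+2a≡n′) ⟩
    + c * horner (suc n′) (Δ^ (double a) (eulerianB k)) t
      ≡⟨ horner-*ˡ (suc n′) (+ c) (Δ^ (double a) (eulerianB k)) t ⟨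
    horner (suc n′) (λ i → + c * Δ^ (double a) (eulerianB k) i) t ∎
    where
    open ≡-Reasoning
    even-power : ∀ x y → x * x ≡ y * y → x ^ double a ≡ y ^ double a
    even-power x y x²≡y² = trans (^-double x a) (trans (cong (_^ a) x²≡y²) (sym (^-double y a)))
    flip : ∀ t → (t - + 1) * (t - + 1) ≡ (+ 1 - t) * (+ 1 - t)
    flip = solve-∀
    reorder : ∀ c b s → c * b * s ≡ c * (s * b)
    reorder = solve-∀

  partialSums^-Δ^-eulerianB : (n′ k a : ℕ) → k ℕ.+ double a ≡ n′ →
    partialSums^ (suc (suc n′)) (Δ^ (double a) (eulerianB k)) ≗ partialSums (λ i → (+ suc (i ℕ.+ i)) ^ k)
  partialSums^-Δ^-eulerianB n′ k a k+2a≡n′ m = begin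
    partialSums^ (suc (suc n′)) (Δ^ (double a) (eulerianB k)) m
      ≡⟨ cong (λ D → partialSums^ D (Δ^ (double a) (eulerianB k)) m) degree ⟩
    partialSums^ (double a ℕ.+ suc (suc k)) (Δ^ (double a) (eulerianB k)) m
      ≡⟨ partialSums^-Δ^ (suc (suc k)) (double a) (eulerianB k) m ⟩
    partialSums (partialSums^ (suc k) (eulerianB k)) m
      ≡⟨ partialSums-cong (worpitzkyB k) m ⟩
    partialSums (λ i → (+ suc (i ℕ.+ i)) ^ k) m ∎
    where
    open ≡-Reasoning
    degree : suc (suc n′) ≡ double a ℕ.+ suc (suc k)
    degree = trans (cong (suc ∘ suc) (sym k+2a≡n′)) (ℕP.+-comm (suc (suc k)) (double a))

  module _ {I : Set} (n′ : ℕ) (is : List I) (k e : I → ℕ)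
           (admissible : All (λ i → ∃[ a ] e i ≡ double a × k i ℕ.+ double a ≡ n′) is)
           (binomial : ∀ x → + 2 * (∑[ i ∈ is ] + (suc n′ C k i) * x ^ k i)
                                ≡ (x + + 1) ^ suc n′ - (x - + 1) ^ suc n′)
           where

    private
      n : ℕ
      n = suc n′

    coefficientsA : Seq
    coefficientsA j = + (2 ℕ.^ n′) * eulerian n j

    B-summand : I → Seq
    B-summand i j = + (n C k i) * Δ^ (e i) (eulerianB (k i)) j

    coefficientsB : Seq
    coefficientsB j = ∑[ i ∈ is ] B-summand i j

    partialSums^-coefficientsA : ∀ m → + 2 * partialSums^ (suc n) coefficientsA m ≡ (+ (suc m ℕ.+ suc m)) ^ n
    partialSums^-coefficientsA m = begin
      + 2 * partialSums^ (suc n) coefficientsA m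
        ≡⟨ cong (+ 2 *_) (partialSums^-*ˡ (suc n) (+ (2 ℕ.^ n′)) (eulerian n) m) ⟩
      + 2 * (+ (2 ℕ.^ n′) * partialSums^ (suc n) (eulerian n) m)
        ≡⟨ cong (λ s → + 2 * (+ (2 ℕ.^ n′) * s)) (worpitzkyA n m) ⟩
      + 2 * (+ (2 ℕ.^ n′) * (+ suc m) ^ n)
        ≡⟨ ℤP.*-assoc (+ 2) (+ (2 ℕ.^ n′)) ((+ suc m) ^ n) ⟨
      + 2 * + (2 ℕ.^ n′) * (+ suc m) ^ n
        ≡⟨ cong (λ s → + 2 * s * (+ suc m) ^ n) (pos-^ 2 n′) ⟩
      (+ 2) ^ n * (+ suc m) ^ n
        ≡⟨ ^-distribʳ-* (+ 2) (+ suc m) n ⟨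
      (+ 2 * + suc m) ^ n
        ≡⟨ cong (_^ n) (trans (sym (ℤP.pos-* 2 (suc m))) (cong (λ s → + (suc m ℕ.+ s)) (ℕP.+-identityʳ (suc m)))) ⟩
      (+ (suc m ℕ.+ suc m)) ^ n ∎
      where open ≡-Reasoning

    partialSums^-coefficientsB : ∀ m → + 2 * partialSums^ (suc n) coefficientsB m ≡ (+ (suc m ℕ.+ suc m)) ^ n
    partialSums^-coefficientsB m = begin
      + 2 * partialSums^ (suc n) coefficientsB m
        ≡⟨ cong (+ 2 *_) (partialSums^-∑ (suc n) is B-summand m) ⟩
      + 2 * (∑[ i ∈ is ] partialSums^ (suc n) (B-summand i) m)
        ≡⟨ cong (+ 2 *_) (∑-cong is reduce) ⟩
      + 2 * (∑[ i ∈ is ] partialSums (λ j → + (n C k i) * oddAt j ^ k i) m)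
        ≡⟨ cong (+ 2 *_) (partialSums-∑ is (λ i j → + (n C k i) * oddAt j ^ k i) m) ⟨
      + 2 * partialSums (λ j → ∑[ i ∈ is ] + (n C k i) * oddAt j ^ k i) m
        ≡⟨ partialSums-*ˡ (+ 2) (λ j → ∑[ i ∈ is ] + (n C k i) * oddAt j ^ k i) m ⟨
      partialSums (λ j → + 2 * (∑[ i ∈ is ] + (n C k i) * oddAt j ^ k i)) m
        ≡⟨ partialSums-cong (λ j → trans (binomial (oddAt j)) (cong (λ s → (+ s) ^ n - (+ (j ℕ.+ j)) ^ n) (next j))) m ⟩
      partialSums (λ j → F (suc j) - F j) m
        ≡⟨ partialSums-telescope F m ⟩
      F (suc m) - F 0
        ≡⟨ cong (_-_ (F (suc m))) (ℤP.*-zeroˡ ((+ 0) ^ n′)) ⟩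
      F (suc m) - + 0
        ≡⟨ ℤP.+-identityʳ (F (suc m)) ⟩
      F (suc m) ∎
      where
      open ≡-Reasoning
      oddAt : ℕ → ℤ
      oddAt j = + suc (j ℕ.+ j)
      F : ℕ → ℤ
      F j = (+ (j ℕ.+ j)) ^ n
      next : ∀ j → suc (j ℕ.+ j) ℕ.+ 1 ≡ suc j ℕ.+ suc j
      next j = cong suc (trans (ℕP.+-comm (j ℕ.+ j) 1) (sym (ℕP.+-suc j j)))
      reduce : ∀ {i} → i ∈ is →
        partialSums^ (suc n) (λ j → + (n C k i) * Δ^ (e i) (eulerianB (k i)) j) m
          ≡ partialSums (λ j → + (n C k i) * oddAt j ^ k i) m
      reduce {i} i∈ with a , e≡ , k+2a≡n′ ← All.lookup admissible i∈ rewrite e≡ = begin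
        partialSums^ (suc n) (λ j → + (n C k i) * Δ^ (double a) (eulerianB (k i)) j) m
          ≡⟨ partialSums^-*ˡ (suc n) (+ (n C k i)) (Δ^ (double a) (eulerianB (k i))) m ⟩
        + (n C k i) * partialSums^ (suc n) (Δ^ (double a) (eulerianB (k i))) m
          ≡⟨ cong (+ (n C k i) *_) (partialSums^-Δ^-eulerianB n′ (k i) a k+2a≡n′ m) ⟩
        + (n C k i) * partialSums (λ j → oddAt j ^ k i) m
          ≡⟨ partialSums-*ˡ (+ (n C k i)) (λ j → oddAt j ^ k i) m ⟨
        partialSums (λ j → + (n C k i) * oddAt j ^ k i) m ∎

    coefficientsA≗coefficientsB : coefficientsA ≗ coefficientsB
    coefficientsA≗coefficientsB = partialSums^-injective (suc n) λ m →
      ℤP.*-cancelˡ-≡ (+ 2) _ _ (trans (partialSums^-coefficientsA m) (sym (partialSums^-coefficientsB m)))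

    eulerianA-via-B : (t : ℤ) → + (2 ℕ.^ n′) * A n t ≡ ∑[ i ∈ is ] + (n C k i) * B (k i) t * (t - + 1) ^ e i
    eulerianA-via-B t = begin
      + (2 ℕ.^ n′) * A n t                      ≡⟨ cong (+ (2 ℕ.^ n′) *_) (A≡horner n t) ⟩
      + (2 ℕ.^ n′) * horner n (eulerian n) t    ≡⟨ horner-*ˡ n (+ (2 ℕ.^ n′)) (eulerian n) t ⟨
      horner n coefficientsA t                  ≡⟨ horner-cong n t coefficientsA≗coefficientsB ⟩
      horner n coefficientsB t                  ≡⟨ horner-∑ n is B-summand t ⟩
      ∑[ i ∈ is ] horner n (B-summand i) t      ≡⟨ ∑-cong is (sym ∘ B-term) ⟩
      ∑[ i ∈ is ] + (n C k i) * B (k i) t * (t - + 1) ^ e i ∎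
      where
      open ≡-Reasoning
      B-term : ∀ {i} → i ∈ is →
        + (n C k i) * B (k i) t * (t - + 1) ^ e i ≡ horner n (λ j → + (n C k i) * Δ^ (e i) (eulerianB (k i)) j) t
      B-term {i} i∈ with a , e≡ , k+2a≡n′ ← All.lookup admissible i∈ rewrite e≡ =
        B-term≡horner n′ (k i) a (n C k i) t k+2a≡n′

  even-case-exponents : (p : ℕ) →
    All (λ r → ∃[ a ] double (suc p) ∸ 2 ℕ.* r ∸ 2 ≡ double a × 2 ℕ.* r ℕ.+ 1 ℕ.+ double a ≡ suc (double p))
        (upTo (suc p))
  even-case-exponents p = All.tabulate λ {r} r∈ → let r≤p = ℕP.≤-pred (∈-upTo⁻ r∈) in
    p ∸ r ,
    trans (cong (λ m → double (suc p) ∸ m ∸ 2) (2*≡double r))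
          (trans (cong (_∸ 2) (double-∸ (suc p) r)) (cong (λ m → double m ∸ 2) (ℕP.+-∸-assoc 1 r≤p))) ,
    trans (cong (ℕ._+ double (p ∸ r)) (2*+1≡suc-double r)) (cong suc (double-split r≤p))

  odd-case-exponents : (p : ℕ) →
    All (λ r → ∃[ a ] suc (double p) ∸ 2 ℕ.* r ∸ 1 ≡ double a × 2 ℕ.* r ℕ.+ double a ≡ double p) (upTo (suc p))
  odd-case-exponents p = All.tabulate λ {r} r∈ → let r≤p = ℕP.≤-pred (∈-upTo⁻ r∈) in
    p ∸ r ,
    trans (cong (λ m → suc (double p) ∸ m ∸ 1) (2*≡double r)) (cong (_∸ 1) (suc-double-∸ p r r≤p)) ,
    trans (cong (ℕ._+ double (p ∸ r)) (2*≡double r)) (double-split r≤p)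

open EulerianIdentities
  using (double; even; odd; parity; double-/2; double-%2; suc-double-%2;
         eulerianA-via-B; even-case-exponents; odd-case-exponents; binomial-difference-even; binomial-difference-odd)
open import Data.Nat using (ℕ; zero; suc; _≤_; _∸_; _%_; _/_; _*_; _+_) renaming (_^_ to _^ℕ_)
open import Data.Nat.Combinatorics using (_C_)
open import Data.Integer using (ℤ; +_; _-_; _^_) renaming (_*_ to _*ℤ_)
open import Data.List using (map; upTo)
open import Data.Product using (_×_; _,_)
open import Relation.Binary.PropositionalEquality using (_≡_; sym; trans)
open import Relation.Nullary using (contradiction)

proposition3p4 : (n : ℕ) → 1 ≤ n →
    ((n % 2 ≡ 0) → (t : ℤ) →
        (+ (2 ^ℕ (n ∸ 1))) *ℤ A n t
          ≡ sumℤ (map (λ r → (+ (n C (2 * r + 1))) *ℤ B (2 * r + 1) t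
                               *ℤ ((t - + 1) ^ (n ∸ 2 * r ∸ 2)))
                      (upTo ((n ∸ 2) / 2 + 1))))
    × ((n % 2 ≡ 1) → (t : ℤ) →
        (+ (2 ^ℕ (n ∸ 1))) *ℤ A n t
          ≡ sumℤ (map (λ r → (+ (n C (2 * r))) *ℤ B (2 * r) t
                               *ℤ ((t - + 1) ^ (n ∸ 2 * r ∸ 1)))
                      (upTo ((n ∸ 1) / 2 + 1))))
proposition3p4 n 1≤n with parity n
... | even zero    = contradiction 1≤n λ ()
... | even (suc p) rewrite double-/2 p =
  (λ _ → eulerianA-via-B (suc (double p)) (upTo (suc p)) (λ r → 2 * r + 1) (λ r → double (suc p) ∸ 2 * r ∸ 2)
           (even-case-exponents p) (binomial-difference-even p)) ,
  (λ n%2≡1 → contradiction (trans (sym n%2≡1) (double-%2 (suc p))) λ ())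
... | odd p rewrite double-/2 p =
  (λ n%2≡0 → contradiction (trans (sym n%2≡0) (suc-double-%2 p)) λ ()) ,
  (λ _ → eulerianA-via-B (double p) (upTo (suc p)) (λ r → 2 * r) (λ r → suc (double p) ∸ 2 * r ∸ 1)
           (odd-case-exponents p) (binomial-difference-odd p))
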